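{- Let $A$ be the adjacency matrix of an Eulerian graph of odd order $n$, and let $\phi$ be the characteristic polynomial of $A$. Suppose that, over $\mathbb{F}_2$, $\phi(x)=x^k\phi_1(x)^2$ for some polynomial $\phi_1\in\mathbb{F}_2[x]$ and some odd integer $k\geq 3$. Then $A^{\frac{k-1}{2}}\phi_1(A)=0$ over $\mathbb{F}_2$.
   Context: An Eulerian graph is a connected graph in which every vertex has even degree. The adjacency matrix is regarded as a matrix over $\mathbb{F}_2$ when evaluating polynomials over $\mathbb{F}_2$. -}

module Defs where

open import Data.Bool using (Bool; true; false; _xor_; _∧_; if_then_else_)
open import Data.Nat using (ℕ; zero; suc; _+_; _%_; _∸_; _/_)
open import Data.Nat.Divisibility using (_∣_)
open import Data.Fin using (Fin; zero; suc; punchIn)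
open import Data.List using (List; []; _∷_)
open import Data.Product using (_×_)
open import Relation.Binary.PropositionalEquality using (_≡_; _≢_)

-- The field F₂ is Bool with  + = xor,  · = ∧.

Odd : ℕ → Set
Odd n = n % 2 ≡ 1

record Graph (n : ℕ) : Set where
  field
    adj       : Fin n → Fin n → Bool
    symmetric : ∀ i j → adj i j ≡ adj j i
    loopless  : ∀ i → adj i i ≡ false

open Graph public

countTrue : ∀ {m} → (Fin m → Bool) → ℕ
countTrue {zero}  f = 0
countTrue {suc m} f = (if f zero then 1 else 0) + countTrue (λ j → f (suc j))

degree : ∀ {n} → Graph n → Fin n → ℕ
degree G v = countTrue (adj G v)

data Reach {n : ℕ} (G : Graph n) : Fin n → Fin n → Set where
  here : ∀ {u} → Reach G u u
  step : ∀ {u v w} → adj G u v ≡ true → Reach G v w → Reach G u w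

Connected : ∀ {n} → Graph n → Set
Connected G = ∀ u v → Reach G u v

Eulerian : ∀ {n} → Graph n → Set
Eulerian G = Connected G × (∀ v → 2 ∣ degree G v)

Mat : ℕ → Set
Mat n = Fin n → Fin n → Bool

sumF2 : ∀ {m} → (Fin m → Bool) → Bool
sumF2 {zero}  f = false
sumF2 {suc m} f = f zero xor sumF2 (λ j → f (suc j))

_⊗_ : ∀ {n} → Mat n → Mat n → Mat n
(M ⊗ N) i k = sumF2 (λ j → M i j ∧ N j k)

_⊕_ : ∀ {n} → Mat n → Mat n → Mat n
(M ⊕ N) i j = M i j xor N i j

δ : ∀ {n} → Fin n → Fin n → Bool
δ zero    zero    = true
δ zero    (suc j) = false
δ (suc i) zero    = false
δ (suc i) (suc j) = δ i j

idM : ∀ {n} → Mat n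
idM = δ

zeroM : ∀ {n} → Mat n
zeroM i j = false

scaleM : ∀ {n} → Bool → Mat n → Mat n
scaleM a M i j = a ∧ M i j

_^M_ : ∀ {n} → Mat n → ℕ → Mat n
M ^M zero  = idM
M ^M suc k = M ⊗ (M ^M k)

adjMatrix : ∀ {n} → Graph n → Mat n
adjMatrix G = adj G

-- Polynomials over F₂: coefficient lists, lowest degree first.
-- Two polynomials are equal when all their coefficients agree
-- (so trailing zero coefficients are irrelevant).

Poly : Set
Poly = List Bool

coeff : Poly → ℕ → Bool
coeff []      i       = false
coeff (a ∷ p) zero    = a
coeff (a ∷ p) (suc i) = coeff p i

_≈P_ : Poly → Poly → Set
p ≈P q = ∀ i → coeff p i ≡ coeff q i

_+P_ : Poly → Poly → Poly
[]      +P q       = q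
(a ∷ p) +P []      = a ∷ p
(a ∷ p) +P (b ∷ q) = (a xor b) ∷ (p +P q)

scaleP : Bool → Poly → Poly
scaleP a []      = []
scaleP a (b ∷ q) = (a ∧ b) ∷ scaleP a q

_*P_ : Poly → Poly → Poly
[]      *P q = []
(a ∷ p) *P q = scaleP a q +P (false ∷ (p *P q))

constP : Bool → Poly
constP a = a ∷ []

X : Poly
X = false ∷ true ∷ []

_^P_ : Poly → ℕ → Poly
p ^P zero  = true ∷ []
p ^P suc k = p *P (p ^P k)

evalM : ∀ {n} → Poly → Mat n → Mat n
evalM []      M = zeroM
evalM (a ∷ p) M = scaleM a idM ⊕ (M ⊗ evalM p M)

-- Determinant of a square matrix with entries in F₂[x], defined by
-- Laplace (cofactor) expansion along the first row.  Over F₂ all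
-- cofactor signs are +1.

sumP : ∀ {m} → (Fin m → Poly) → Poly
sumP {zero}  f = []
sumP {suc m} f = f zero +P sumP (λ j → f (suc j))

minor : ∀ {m} → (Fin (suc m) → Fin (suc m) → Poly) → Fin (suc m)
      → Fin m → Fin m → Poly
minor M j r c = M (suc r) (punchIn j c)

detP : ∀ {m} → (Fin m → Fin m → Poly) → Poly
detP {zero}  M = true ∷ []
detP {suc m} M = sumP (λ j → M zero j *P detP (minor M j))

-- characteristic polynomial det(xI − A) over F₂  (− = + in F₂)
charPoly : ∀ {n} → Mat n → Poly
charPoly A = detP (λ i j → (if δ i j then X else []) +P constP (A i j))

-- Over F₂ the determinant is the permanent, and for a symmetric matrix only
-- involutions survive: det(xI + A) is the sum over the partial matchings of the
-- vertex set, with weight x for each unmatched vertex and A_ab for each matched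
-- pair.  For such matching sums on an odd number n of vertices one shows
-- φ = x Σ_b φ_{V∖b}, and on each of the even sets V∖b the matching sum is the
-- square of the hafnian (in characteristic 2, the Pfaffian) of x(J + I) + A.
-- Hence φ = x Ψ², where Ψ is the hafnian of the bordered matrix
-- S = [[0, 1ᵀ], [1, x(J + I) + A]], and comparing with φ = x^k φ₁² gives
-- Ψ = x^((k-1)/2) φ₁.  Cramer's rule for the hafnian of S, evaluated at x = A
-- acting on F₂ⁿ, gives Ψ(A) e_j = Ψ(A) 𝟙 for every j, because every row of A
-- has even weight; and Ψ(A) 𝟙 = 0 because x divides Ψ and A 𝟙 = 0.

module Submission where

open import Defs
open import Data.Nat using (ℕ; _≤_; _∸_; _/_)
open import Data.Bool using (Bool; false)
open import Data.Fin using (Fin)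
open import Data.Product using (Σ)
open import Relation.Binary.PropositionalEquality using (_≡_)

open import Algebra.Bundles using (CommutativeMonoid; CommutativeSemiring; CommutativeRing)
open import Algebra.Module.Bundles using (LeftSemimodule)
import Algebra.Construct.Pointwise
import Relation.Binary.Reasoning.Setoid
open import Algebra.Structures using (IsCommutativeMonoid)
open import Algebra.Structures.Biased using (isCommutativeMonoidˡ; isCommutativeSemiringˡ)
open import Data.Bool using (true; _xor_; _∧_; if_then_else_)
open import Data.Bool.Properties
  using ( xor-∧-commutativeRing; xor-identityʳ; xor-assoc; xor-comm; xor-same
        ; ∧-idem; ∧-zeroʳ; ∧-identityʳ; ∧-assoc; ∧-comm; ∧-distribˡ-xor; ∧-distribʳ-xor)
open import Data.Nat as ℕ using (zero; suc; s≤s; _%_)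
open import Data.Nat.Divisibility using (_∣_; divides)
open import Data.Nat.Properties using (≤-refl; ≤-trans; suc-injective; *-suc; +-suc)
import Data.Nat.Properties as ℕₚ
open import Data.Nat.DivMod using (m≡m%n+[m/n]*n; m*n/n≡m)
open import Data.Fin as Fin using (zero; suc; punchIn)
open import Data.Fin.Properties as Fin using ()
open import Data.List using (List; []; _∷_; length; map; filter; tabulate; allFin)
open import Data.List.Properties using (filter-accept; filter-reject; length-filter; map-tabulate; length-tabulate)
open import Data.List.Membership.Propositional using (_∈_; _∉_)
open import Data.List.Membership.Propositional.Properties using (∈-filter⁺; ∈-filter⁻; ∈-tabulate⁺; ∈-tabulate⁻)
import Data.List.Relation.Unary.All as All
open import Data.List.Relation.Unary.All.Properties using (All¬⇒¬Any; ¬Any⇒All¬)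
open import Data.List.Relation.Unary.Any using (here; there)
import Data.List.Relation.Unary.Unique.Propositional as UniqueList
import Data.List.Relation.Unary.Unique.Propositional.Properties as Unique
open import Data.Product using (_,_; proj₁; proj₂; ∃-syntax)
open import Function using (_∘_; id)
open import Data.Vec.Functional using (Vector)
open import Level using (Level; _⊔_; 0ℓ)
open import Relation.Binary.Definitions using (DecidableEquality)
open import Relation.Binary.Structures using (IsEquivalence)
open import Relation.Binary.Bundles using (Setoid)
import Relation.Binary.PropositionalEquality as ≡
open ≡ using (_≢_; _≗_)
open import Relation.Nullary using (Dec; yes; no)
open import Relation.Nullary.Decidable using (¬?)
open import Relation.Nullary.Negation using (contradiction)

-- Deletion from lists, and finite sums over lists

module Deletion {i} {I : Set i} (_≟_ : DecidableEquality I) where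

  open ≡ using (refl; sym; trans; cong; module ≡-Reasoning)

  open UniqueList {A = I} using (Unique; []; _∷_) public

  infixl 6 _∖_

  _∖_ : List I → I → List I
  L ∖ b = filter (λ a → ¬? (a ≟ b)) L

  ∖-∷-≢ : ∀ {a b} L → a ≢ b → (a ∷ L) ∖ b ≡ a ∷ (L ∖ b)
  ∖-∷-≢ L = filter-accept (λ a → ¬? (a ≟ _))

  ∖-∷-≡ : ∀ a L → (a ∷ L) ∖ a ≡ L ∖ a
  ∖-∷-≡ a L = filter-reject (λ c → ¬? (c ≟ a)) (λ a≢a → a≢a refl)

  ∖-∉ : ∀ {b} L → b ∉ L → L ∖ b ≡ L
  ∖-∉ [] b∉L = refl
  ∖-∉ (a ∷ L) b∉a∷L =
    trans (∖-∷-≢ L (λ a≡b → b∉a∷L (here (sym a≡b)))) (cong (a ∷_) (∖-∉ L (b∉a∷L ∘ there)))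

  ∖-head : ∀ {a L} → a ∉ L → (a ∷ L) ∖ a ≡ L
  ∖-head {a} {L} a∉L = trans (∖-∷-≡ a L) (∖-∉ L a∉L)

  ∖-comm : ∀ b d L → L ∖ b ∖ d ≡ L ∖ d ∖ b
  ∖-comm b d [] = refl
  ∖-comm b d (a ∷ L) = by-cases (a ≟ b) (a ≟ d)
    where
    open ≡-Reasoning
    head-first : ∀ {x} → a ≢ x → (a ∷ L) ∖ a ∖ x ≡ (a ∷ L) ∖ x ∖ a
    head-first {x} a≢x = begin
      (a ∷ L) ∖ a ∖ x   ≡⟨ cong (_∖ x) (∖-∷-≡ a L) ⟩
      L ∖ a ∖ x         ≡⟨ ∖-comm a x L ⟩
      L ∖ x ∖ a         ≡⟨ ∖-∷-≡ a (L ∖ x) ⟨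
      (a ∷ L ∖ x) ∖ a   ≡⟨ cong (_∖ a) (∖-∷-≢ L a≢x) ⟨
      (a ∷ L) ∖ x ∖ a   ∎
    by-cases : Dec (a ≡ b) → Dec (a ≡ d) → (a ∷ L) ∖ b ∖ d ≡ (a ∷ L) ∖ d ∖ b
    by-cases (yes refl) (yes refl) = refl
    by-cases (yes refl) (no a≢d)   = head-first a≢d
    by-cases (no a≢b)   (yes refl) = sym (head-first a≢b)
    by-cases (no a≢b)   (no a≢d)   = begin
      (a ∷ L) ∖ b ∖ d   ≡⟨ cong (_∖ d) (∖-∷-≢ L a≢b) ⟩
      (a ∷ L ∖ b) ∖ d   ≡⟨ ∖-∷-≢ (L ∖ b) a≢d ⟩
      a ∷ L ∖ b ∖ d     ≡⟨ cong (a ∷_) (∖-comm b d L) ⟩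
      a ∷ L ∖ d ∖ b     ≡⟨ ∖-∷-≢ (L ∖ d) a≢b ⟨
      (a ∷ L ∖ d) ∖ b   ≡⟨ cong (_∖ b) (∖-∷-≢ L a≢d) ⟨
      (a ∷ L) ∖ d ∖ b   ∎

  ∈-∖⁺ : ∀ {a b L} → a ∈ L → a ≢ b → a ∈ L ∖ b
  ∈-∖⁺ = ∈-filter⁺ (λ c → ¬? (c ≟ _))

  ∈-∖⇒∈ : ∀ {a b} L → a ∈ L ∖ b → a ∈ L
  ∈-∖⇒∈ L = proj₁ ∘ ∈-filter⁻ (λ c → ¬? (c ≟ _)) {xs = L}

  ∈-∖⇒≢ : ∀ {a b} L → a ∈ L ∖ b → a ≢ b
  ∈-∖⇒≢ L = proj₂ ∘ ∈-filter⁻ (λ c → ¬? (c ≟ _)) {xs = L}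

  Unique-∖ : ∀ {L} b → Unique L → Unique (L ∖ b)
  Unique-∖ b = Unique.filter⁺ (λ c → ¬? (c ≟ b))

  length-∖-≤ : ∀ b L → length (L ∖ b) ≤ length L
  length-∖-≤ b = length-filter (λ c → ¬? (c ≟ b))

  head∉tail : ∀ {a L} → Unique (a ∷ L) → a ∉ L
  head∉tail (a≢L ∷ _) = All¬⇒¬Any a≢L

  head≢tail : ∀ {a b L} → Unique (a ∷ L) → b ∈ L → a ≢ b
  head≢tail (a≢L ∷ _) = All.lookup a≢L

  length-∖ : ∀ {b L} → Unique L → b ∈ L → suc (length (L ∖ b)) ≡ length L
  length-∖ {b} {a ∷ L} uL (here refl) = cong (suc ∘ length) (∖-head (head∉tail uL))
  length-∖ {b} {a ∷ L} uL@(_ ∷ uL′) (there b∈L) =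
    trans (cong (suc ∘ length) (∖-∷-≢ L (head≢tail uL b∈L))) (cong suc (length-∖ uL′ b∈L))

  ∖-tabulate : ∀ {m} (f : Fin (suc m) → I) → (∀ {r s} → f r ≡ f s → r ≡ s) →
               ∀ r → tabulate f ∖ f r ≡ tabulate (f ∘ punchIn r)
  ∖-tabulate f f-inj zero = ∖-head (Fin.0≢1+n ∘ f-inj ∘ proj₂ ∘ ∈-tabulate⁻)
  ∖-tabulate {suc m} f f-inj (suc r) =
    trans (∖-∷-≢ (tabulate (f ∘ suc)) (Fin.0≢1+n ∘ f-inj))
          (cong (f zero ∷_) (∖-tabulate (f ∘ suc) (Fin.suc-injective ∘ f-inj) r))

module ListSum {c ℓ} (M : CommutativeMonoid c ℓ) where

  open CommutativeMonoid M renaming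
    (_∙_ to _+_; ε to 0#; ∙-cong to +-cong; ∙-congˡ to +-congˡ; identityˡ to +-identityˡ)
  open import Algebra.Properties.CommutativeSemigroup commutativeSemigroup using (interchange)

  private
    variable
      i : Level
      I : Set i

  sumOver : (I → Carrier) → List I → Carrier
  sumOver f []      = 0#
  sumOver f (a ∷ L) = f a + sumOver f L

  syntax sumOver (λ b → e) L = ∑[ b ∈ L ] e

  ∑-cong : ∀ {f g : I → Carrier} L → (∀ {b} → b ∈ L → f b ≈ g b) → sumOver f L ≈ sumOver g L
  ∑-cong []      f≈g = refl
  ∑-cong (a ∷ L) f≈g = +-cong (f≈g (here ≡.refl)) (∑-cong L (f≈g ∘ there))

  ∑-zero : ∀ {f : I → Carrier} L → (∀ {b} → b ∈ L → f b ≈ 0#) → sumOver f L ≈ 0#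
  ∑-zero []      f≈0 = refl
  ∑-zero (a ∷ L) f≈0 = trans (+-cong (f≈0 (here ≡.refl)) (∑-zero L (f≈0 ∘ there))) (+-identityˡ 0#)

  ∑-distrib-+ : ∀ (f g : I → Carrier) L → ∑[ b ∈ L ] (f b + g b) ≈ sumOver f L + sumOver g L
  ∑-distrib-+ f g []      = sym (+-identityˡ 0#)
  ∑-distrib-+ f g (a ∷ L) = trans (+-congˡ (∑-distrib-+ f g L)) (interchange (f a) (g a) _ _)

  ∑-comm : ∀ {j} {J : Set j} (f : I → J → Carrier) L L′ →
           ∑[ b ∈ L ] ∑[ d ∈ L′ ] f b d ≈ ∑[ d ∈ L′ ] ∑[ b ∈ L ] f b d
  ∑-comm f []      L′ = sym (∑-zero L′ (λ _ → refl))
  ∑-comm f (a ∷ L) L′ = trans (+-congˡ (∑-comm f L L′)) (sym (∑-distrib-+ (f a) _ L′))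

  ∑-map : ∀ {j} {J : Set j} (f : I → Carrier) (g : J → I) L → sumOver f (map g L) ≡ ∑[ b ∈ L ] f (g b)
  ∑-map f g []      = ≡.refl
  ∑-map f g (a ∷ L) = ≡.cong (f (g a) +_) (∑-map f g L)

  ∑-tabulate : ∀ {m} (f : I → Carrier) (g : Fin m → I) → sumOver f (tabulate g) ≡ ∑[ k ∈ allFin m ] f (g k)
  ∑-tabulate f g = ≡.trans (≡.cong (sumOver f) (≡.sym (map-tabulate id g))) (∑-map f g (allFin _))

module SemiringSum {c ℓ} (R : CommutativeSemiring c ℓ) where

  open CommutativeSemiring R hiding (zero)
  open ListSum +-commutativeMonoid public

  private
    variable
      i : Level
      I : Set i

  *-distribˡ-∑ : ∀ x (f : I → Carrier) L → x * sumOver f L ≈ ∑[ b ∈ L ] (x * f b)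
  *-distribˡ-∑ x f []      = zeroʳ x
  *-distribˡ-∑ x f (a ∷ L) = trans (distribˡ x (f a) (sumOver f L)) (+-congˡ (*-distribˡ-∑ x f L))

module DeletionSum {c ℓ} (M : CommutativeMonoid c ℓ) {i} {I : Set i} (_≟_ : DecidableEquality I) where

  open CommutativeMonoid M renaming
    (_∙_ to _+_; ε to 0#; ∙-cong to +-cong; ∙-congˡ to +-congˡ)
  open ListSum M
  open Deletion _≟_
  open import Algebra.Properties.CommutativeSemigroup commutativeSemigroup using (x∙yz≈y∙xz)
  open import Relation.Binary.Reasoning.Setoid setoid

  ∑-remove : ∀ (f : I → Carrier) {b L} → Unique L → b ∈ L → sumOver f L ≈ f b + sumOver f (L ∖ b)
  ∑-remove f {b} {a ∷ L} uL (here ≡.refl) =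
    +-congˡ (reflexive (≡.cong (sumOver f) (≡.sym (∖-head (head∉tail uL)))))
  ∑-remove f {b} {a ∷ L} uL@(_ ∷ uL′) (there b∈L) = begin
    f a + sumOver f L                  ≈⟨ +-congˡ (∑-remove f uL′ b∈L) ⟩
    f a + (f b + sumOver f (L ∖ b))    ≈⟨ x∙yz≈y∙xz (f a) (f b) _ ⟩
    f b + (f a + sumOver f (L ∖ b))    ≡⟨ ≡.cong (λ L′ → f b + sumOver f L′) (∖-∷-≢ L (head≢tail uL b∈L)) ⟨
    f b + sumOver f ((a ∷ L) ∖ b)      ∎

  pairSum : (I → I → Carrier) → List I → Carrier
  pairSum f L = ∑[ b ∈ L ] ∑[ d ∈ L ∖ b ] f b d

  pairSum-∷ : ∀ (f : I → I → Carrier) {a L} → Unique (a ∷ L) →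
              pairSum f (a ∷ L) ≈ ∑[ d ∈ L ] f a d + (∑[ b ∈ L ] f b a + pairSum f L)
  pairSum-∷ f {a} {L} uaL = +-cong
    (reflexive (≡.cong (sumOver (f a)) (∖-head (head∉tail uaL))))
    (begin
      ∑[ b ∈ L ] ∑[ d ∈ (a ∷ L) ∖ b ] f b d
        ≈⟨ ∑-cong L (λ b∈L → reflexive (≡.cong (sumOver (f _)) (∖-∷-≢ L (head≢tail uaL b∈L)))) ⟩
      ∑[ b ∈ L ] (f b a + ∑[ d ∈ L ∖ b ] f b d)
        ≈⟨ ∑-distrib-+ (λ b → f b a) _ L ⟩
      ∑[ b ∈ L ] f b a + pairSum f L ∎)

  pairSum-transpose : ∀ (f : I → I → Carrier) {L} → Unique L → pairSum f L ≈ pairSum (λ b d → f d b) L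
  pairSum-transpose f {[]}    uL = refl
  pairSum-transpose f {a ∷ L} uL@(_ ∷ uL′) = begin
    pairSum f (a ∷ L)                                           ≈⟨ pairSum-∷ f uL ⟩
    ∑[ d ∈ L ] f a d + (∑[ b ∈ L ] f b a + pairSum f L)         ≈⟨ +-congˡ (+-congˡ (pairSum-transpose f uL′)) ⟩
    ∑[ d ∈ L ] f a d + (∑[ b ∈ L ] f b a + pairSum fᵀ L)        ≈⟨ x∙yz≈y∙xz _ _ _ ⟩
    ∑[ b ∈ L ] f b a + (∑[ d ∈ L ] f a d + pairSum fᵀ L)        ≈⟨ pairSum-∷ fᵀ uL ⟨
    pairSum fᵀ (a ∷ L)                                          ∎
    where
    fᵀ = λ b d → f d b

module ModuleSum {c ℓ m ℓm} (R : CommutativeSemiring c ℓ)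
                 (M : LeftSemimodule (CommutativeSemiring.semiring R) m ℓm) where

  open CommutativeSemiring R using (Carrier)
  open LeftSemimodule M
  module Scalar = SemiringSum R
  open ListSum +ᴹ-commutativeMonoid public

  private
    variable
      i : Level
      I : Set i

  *ₗ-distribˡ-∑ : ∀ x (f : I → Carrierᴹ) L → x *ₗ sumOver f L ≈ᴹ ∑[ b ∈ L ] (x *ₗ f b)
  *ₗ-distribˡ-∑ x f []      = *ₗ-zeroʳ x
  *ₗ-distribˡ-∑ x f (a ∷ L) = ≈ᴹ-trans (*ₗ-distribˡ x (f a) (sumOver f L)) (+ᴹ-congˡ (*ₗ-distribˡ-∑ x f L))

  *ₗ-distribʳ-∑ : ∀ (f : I → Carrier) u L → Scalar.sumOver f L *ₗ u ≈ᴹ ∑[ b ∈ L ] (f b *ₗ u)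
  *ₗ-distribʳ-∑ f u []      = *ₗ-zeroˡ u
  *ₗ-distribʳ-∑ f u (a ∷ L) = ≈ᴹ-trans (*ₗ-distribʳ u (f a) (Scalar.sumOver f L)) (+ᴹ-congˡ (*ₗ-distribʳ-∑ f u L))

Characteristic2 : ∀ {c ℓ} → CommutativeSemiring c ℓ → Set (c ⊔ ℓ)
Characteristic2 R = ∀ x → x + x ≈ 0#
  where open CommutativeSemiring R

module Characteristic2Properties {c ℓ} (R : CommutativeSemiring c ℓ) (char2 : Characteristic2 R) where

  open CommutativeSemiring R hiding (zero)
  open SemiringSum R
  open import Algebra.Properties.Monoid.Mult +-monoid using (_×_; ×-homo-+)
  open import Relation.Binary.Reasoning.Setoid setoid
  open import Algebra.Solver.Ring.NaturalCoefficients.Default R using (solve; _:+_; _:*_; _:=_)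

  private
    variable
      i : Level
      I : Set i

  infix 8 _²

  _² : Carrier → Carrier
  x ² = x * x

  square-+ : ∀ x y → (x + y) ² ≈ x ² + y ²
  square-+ x y = begin
    (x + y) ²                   ≈⟨ solve 2 (λ x y → (x :+ y) :* (x :+ y) := x :* x :+ y :* y :+ (x :* y :+ x :* y)) refl x y ⟩
    x ² + y ² + (x * y + x * y) ≈⟨ +-congˡ (char2 (x * y)) ⟩
    x ² + y ² + 0#              ≈⟨ +-identityʳ _ ⟩
    x ² + y ²                   ∎

  square-* : ∀ x y → (x * y) ² ≈ x ² * y ²
  square-* = solve 2 (λ x y → (x :* y) :* (x :* y) := (x :* x) :* (y :* y)) refl

  ∑-square : ∀ (f : I → Carrier) L → sumOver f L ² ≈ ∑[ b ∈ L ] (f b ²)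
  ∑-square f []      = zeroˡ 0#
  ∑-square f (a ∷ L) = trans (square-+ (f a) (sumOver f L)) (+-congˡ (∑-square f L))

  ×-even : ∀ m x → (2 ℕ.* m) × x ≈ 0#
  ×-even m x = begin
    (m ℕ.+ (m ℕ.+ 0)) × x   ≡⟨ ≡.cong (λ k → (m ℕ.+ k) × x) (ℕₚ.+-identityʳ m) ⟩
    (m ℕ.+ m) × x           ≈⟨ ×-homo-+ x m m ⟩
    m × x + m × x           ≈⟨ char2 (m × x) ⟩
    0#                      ∎

  ×-odd : ∀ m x → suc (2 ℕ.* m) × x ≈ x
  ×-odd m x = trans (+-congˡ (×-even m x)) (+-identityʳ x)

  ∑∑-symmetric : ∀ (f : I → I → Carrier) L → (∀ b d → f b d ≈ f d b) →
                 ∑[ b ∈ L ] ∑[ d ∈ L ] f b d ≈ ∑[ b ∈ L ] f b b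
  ∑∑-symmetric f []      f-sym = refl
  ∑∑-symmetric f (a ∷ L) f-sym = begin
    (f a a + ∑[ d ∈ L ] f a d) + ∑[ b ∈ L ] (f b a + ∑[ d ∈ L ] f b d)
      ≈⟨ +-congˡ (∑-distrib-+ (λ b → f b a) _ L) ⟩
    (f a a + ∑[ d ∈ L ] f a d) + (∑[ b ∈ L ] f b a + ∑[ b ∈ L ] ∑[ d ∈ L ] f b d)
      ≈⟨ solve 4 (λ x s t u → (x :+ s) :+ (t :+ u) := x :+ (s :+ t) :+ u) refl _ _ _ _ ⟩
    f a a + (∑[ d ∈ L ] f a d + ∑[ b ∈ L ] f b a) + ∑[ b ∈ L ] ∑[ d ∈ L ] f b d
      ≈⟨ +-cong (+-congˡ (trans (+-congˡ (∑-cong L (λ {b} _ → f-sym b a))) (char2 _))) (∑∑-symmetric f L f-sym) ⟩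
    f a a + 0# + ∑[ b ∈ L ] f b b
      ≈⟨ +-congʳ (+-identityʳ (f a a)) ⟩
    f a a + ∑[ b ∈ L ] f b b  ∎

-- Permanents, matching sums and hafnians

module Permanent {c ℓ} (R : CommutativeSemiring c ℓ) where

  open CommutativeSemiring R hiding (zero)
  open SemiringSum R
  open import Algebra.Properties.CommutativeSemigroup *-commutativeSemigroup
    using () renaming (x∙yz≈y∙xz to x*yz≈y*xz)
  open import Relation.Binary.Reasoning.Setoid setoid

  Matrix : ℕ → Set c
  Matrix m = Fin m → Fin m → Carrier

  _ᵀ : ∀ {m} → Matrix m → Matrix m
  (M ᵀ) r c = M c r

  firstRowMinor : ∀ {m} → Matrix (suc m) → Fin (suc m) → Matrix m
  firstRowMinor M j r c = M (suc r) (punchIn j c)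

  firstColumnMinor : ∀ {m} → Matrix (suc m) → Fin (suc m) → Matrix m
  firstColumnMinor M i r c = M (punchIn i r) (suc c)

  permanent : ∀ {m} → Matrix m → Carrier
  permanent {zero}  M = 1#
  permanent {suc m} M = ∑[ j ∈ allFin (suc m) ] (M zero j * permanent (firstRowMinor M j))

  permanent-cong : ∀ {m} {M N : Matrix m} → (∀ r c → M r c ≈ N r c) → permanent M ≈ permanent N
  permanent-cong {zero}  M≈N = refl
  permanent-cong {suc m} M≈N = ∑-cong (allFin (suc m)) λ {j} _ →
    *-cong (M≈N zero j) (permanent-cong (λ r c → M≈N (suc r) (punchIn j c)))

  doubleMinor : ∀ {m} → Matrix (suc (suc m)) → Fin (suc m) → Fin (suc m) → Matrix m
  doubleMinor M i j r c = M (suc (punchIn i r)) (suc (punchIn j c))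

  permanent-expandFirstColumn : ∀ {m} (M : Matrix (suc m)) →
    permanent M ≈ ∑[ i ∈ allFin (suc m) ] (M i zero * permanent (firstColumnMinor M i))

  permanent-expandFirstRowAndColumn : ∀ {m} (M : Matrix (suc (suc m))) →
    permanent M ≈ M zero zero * permanent (firstRowMinor M zero) +
      ∑[ i ∈ allFin (suc m) ] ∑[ j ∈ allFin (suc m) ] (M (suc i) zero * (M zero (suc j) * permanent (doubleMinor M i j)))
  permanent-expandFirstRowAndColumn {m} M = +-congˡ (begin
    ∑[ j ∈ tabulate suc ] rowTerm j
      ≡⟨ ∑-tabulate rowTerm Fin.suc ⟩
    ∑[ j ∈ J ] rowTerm (suc j)
      ≈⟨ ∑-cong J (λ {j} _ → *-congˡ (permanent-expandFirstColumn (firstRowMinor M (suc j)))) ⟩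
    ∑[ j ∈ J ] (M zero (suc j) * ∑[ i ∈ J ] (M (suc i) zero * permanent (doubleMinor M i j)))
      ≈⟨ ∑-cong J (λ {j} _ → *-distribˡ-∑ (M zero (suc j)) _ J) ⟩
    ∑[ j ∈ J ] ∑[ i ∈ J ] (M zero (suc j) * (M (suc i) zero * permanent (doubleMinor M i j)))
      ≈⟨ ∑-comm _ J J ⟩
    ∑[ i ∈ J ] ∑[ j ∈ J ] (M zero (suc j) * (M (suc i) zero * permanent (doubleMinor M i j)))
      ≈⟨ ∑-cong J (λ _ → ∑-cong J (λ _ → x*yz≈y*xz _ _ _)) ⟩
    ∑[ i ∈ J ] ∑[ j ∈ J ] (M (suc i) zero * (M zero (suc j) * permanent (doubleMinor M i j))) ∎)
    where
    J = allFin (suc m)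
    rowTerm : Fin (suc (suc m)) → Carrier
    rowTerm j = M zero j * permanent (firstRowMinor M j)

  permanent-expandFirstColumn {zero}  M = refl
  permanent-expandFirstColumn {suc m} M = trans (permanent-expandFirstRowAndColumn M) (+-congˡ (begin
    ∑[ i ∈ J ] ∑[ j ∈ J ] (M (suc i) zero * (M zero (suc j) * permanent (doubleMinor M i j)))
      ≈⟨ ∑-cong J (λ {i} _ → *-distribˡ-∑ (M (suc i) zero) _ J) ⟨
    ∑[ i ∈ J ] columnTerm (suc i)
      ≡⟨ ∑-tabulate columnTerm Fin.suc ⟨
    ∑[ i ∈ tabulate suc ] columnTerm i ∎))
    where
    J = allFin (suc m)
    columnTerm : Fin (suc (suc m)) → Carrier
    columnTerm i = M i zero * permanent (firstColumnMinor M i)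

  permanent-transpose : ∀ {m} (M : Matrix m) → permanent (M ᵀ) ≈ permanent M
  permanent-transpose {zero}  M = refl
  permanent-transpose {suc m} M = begin
    permanent (M ᵀ)
      ≈⟨ ∑-cong (allFin (suc m)) (λ {i} _ → *-congˡ (permanent-transpose (firstColumnMinor M i))) ⟩
    ∑[ i ∈ allFin (suc m) ] (M i zero * permanent (firstColumnMinor M i))
      ≈⟨ permanent-expandFirstColumn M ⟨
    permanent M ∎

module MatchingSum {c ℓ} (R : CommutativeSemiring c ℓ) {i} {I : Set i} (_≟_ : DecidableEquality I) where

  open CommutativeSemiring R hiding (zero)
  open SemiringSum R
  open DeletionSum +-commutativeMonoid _≟_
  open Deletion _≟_
  open import Algebra.Properties.CommutativeSemigroup *-commutativeSemigroup
    using () renaming (x∙yz≈y∙xz to x*yz≈y*xz)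
  open import Relation.Binary.Reasoning.Setoid setoid

  -- Sum over the partial matchings of L of the product of d a over the unmatched a
  -- and of w a b over the matched pairs (a before b in L).  The number is fuel:
  -- every n ≥ length L gives the same value.
  matchingSumWithin : ℕ → (I → Carrier) → (I → I → Carrier) → List I → Carrier
  matchingSumWithin _       d w []      = 1#
  matchingSumWithin zero    d w (a ∷ L) = 0#
  matchingSumWithin (suc n) d w (a ∷ L) =
    d a * matchingSumWithin n d w L + ∑[ b ∈ L ] (w a b * matchingSumWithin n d w (L ∖ b))

  matchingSum : (I → Carrier) → (I → I → Carrier) → List I → Carrier
  matchingSum d w L = matchingSumWithin (length L) d w L

  matchingSumWithin-fuel : ∀ {n n′} d w L → length L ≤ n → length L ≤ n′ →
                           matchingSumWithin n d w L ≈ matchingSumWithin n′ d w L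
  matchingSumWithin-fuel                 d w []      _           _            = refl
  matchingSumWithin-fuel {suc n} {suc n′} d w (a ∷ L) (s≤s |L|≤n) (s≤s |L|≤n′) =
    +-cong (*-congˡ (matchingSumWithin-fuel d w L |L|≤n |L|≤n′)) (∑-cong L λ {b} _ → *-congˡ
      (matchingSumWithin-fuel d w (L ∖ b) (≤-trans (length-∖-≤ b L) |L|≤n) (≤-trans (length-∖-≤ b L) |L|≤n′)))

  matchingSum-∷ : ∀ d w a L →
    matchingSum d w (a ∷ L) ≈ d a * matchingSum d w L + ∑[ b ∈ L ] (w a b * matchingSum d w (L ∖ b))
  matchingSum-∷ d w a L =
    +-congˡ (∑-cong L λ {b} _ → *-congˡ (matchingSumWithin-fuel d w (L ∖ b) (length-∖-≤ b L) ≤-refl))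

  matchingSum-cong : ∀ {d d′ w w′ L} → Unique L →
    (∀ {a} → a ∈ L → d a ≈ d′ a) → (∀ {a b} → a ∈ L → b ∈ L → a ≢ b → w a b ≈ w′ a b) →
    matchingSum d w L ≈ matchingSum d′ w′ L
  matchingSum-cong {L = L} = within-cong (length L)
    where
    within-cong : ∀ n {d d′ w w′ L} → Unique L →
      (∀ {a} → a ∈ L → d a ≈ d′ a) → (∀ {a b} → a ∈ L → b ∈ L → a ≢ b → w a b ≈ w′ a b) →
      matchingSumWithin n d w L ≈ matchingSumWithin n d′ w′ L
    within-cong _       {L = []}    _  _   _   = refl
    within-cong zero    {L = _ ∷ _} _  _   _   = refl
    within-cong (suc n) {L = a ∷ L} uL@(_ ∷ uL′) d≈d′ w≈w′ = +-cong
      (*-cong (d≈d′ (here ≡.refl)) (within-cong n uL′ (d≈d′ ∘ there) λ a∈L b∈L → w≈w′ (there a∈L) (there b∈L)))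
      (∑-cong L λ b∈L → *-cong (w≈w′ (here ≡.refl) (there b∈L) (head≢tail uL b∈L))
        (within-cong n (Unique-∖ _ uL′) (d≈d′ ∘ there ∘ ∈-∖⇒∈ L)
          λ a∈L∖b c∈L∖b → w≈w′ (there (∈-∖⇒∈ L a∈L∖b)) (there (∈-∖⇒∈ L c∈L∖b))))

  -- In characteristic 2 this is the Pfaffian.
  hafnian : (I → I → Carrier) → List I → Carrier
  hafnian T = matchingSum (λ _ → 0#) T

  hafnian-∷ : ∀ T a L → hafnian T (a ∷ L) ≈ ∑[ b ∈ L ] (T a b * hafnian T (L ∖ b))
  hafnian-∷ T a L = begin
    hafnian T (a ∷ L)                                          ≈⟨ matchingSum-∷ _ T a L ⟩
    0# * hafnian T L + ∑[ b ∈ L ] (T a b * hafnian T (L ∖ b))  ≈⟨ +-congʳ (zeroˡ _) ⟩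
    0# + ∑[ b ∈ L ] (T a b * hafnian T (L ∖ b))                ≈⟨ +-identityˡ _ ⟩
    ∑[ b ∈ L ] (T a b * hafnian T (L ∖ b))                     ∎

  module _ (T : I → I → Carrier) (T-sym : ∀ a b → T a b ≈ T b a) where

    hafnian-bringToFront : ∀ {k L} → Unique L → k ∈ L → hafnian T L ≈ hafnian T (k ∷ L ∖ k)
    hafnian-bringToFront {L = L} = within (length L) ≤-refl
      where
      within : ∀ n {k L} → length L ≤ n → Unique L → k ∈ L → hafnian T L ≈ hafnian T (k ∷ L ∖ k)
      within n       {L = a ∷ L′} _           uL (here ≡.refl) =
        reflexive (≡.cong (hafnian T ∘ (a ∷_)) (≡.sym (∖-head (head∉tail uL))))
      within (suc n) {k} {a ∷ L′} (s≤s |L′|≤n) uL@(_ ∷ uL′) (there k∈L′) = begin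
        hafnian T (a ∷ L′)
          ≈⟨ hafnian-∷ T a L′ ⟩
        ∑[ b ∈ L′ ] (T a b * hafnian T (L′ ∖ b))
          ≈⟨ ∑-remove _ uL′ k∈L′ ⟩
        T a k * hafnian T L″ + ∑[ b ∈ L″ ] (T a b * hafnian T (L′ ∖ b))
          ≈⟨ +-cong (*-congʳ (T-sym a k)) (∑-cong L″ expand-L′∖b) ⟩
        T k a * hafnian T L″ + pairSum (λ b d → T a b * (T k d * hafnian T (L″ ∖ b ∖ d))) L″
          ≈⟨ +-congˡ (pairSum-transpose _ (Unique-∖ k uL′)) ⟩
        T k a * hafnian T L″ + pairSum (λ b d → T a d * (T k b * hafnian T (L″ ∖ d ∖ b))) L″
          ≈⟨ +-cong (*-congˡ (reflexive (≡.cong (hafnian T) (≡.sym (∖-head a∉L″))))) (∑-cong L″ collect-a) ⟩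
        ∑[ b ∈ a ∷ L″ ] (T k b * hafnian T ((a ∷ L″) ∖ b))
          ≈⟨ hafnian-∷ T k (a ∷ L″) ⟨
        hafnian T (k ∷ a ∷ L″)
          ≡⟨ ≡.cong (hafnian T ∘ (k ∷_)) (∖-∷-≢ L′ a≢k) ⟨
        hafnian T (k ∷ (a ∷ L′) ∖ k) ∎
        where
        L″ = L′ ∖ k
        a≢k = head≢tail uL k∈L′
        a∉L″ : a ∉ L″
        a∉L″ = head∉tail uL ∘ ∈-∖⇒∈ L′
        expand-L′∖b : ∀ {b} → b ∈ L″ →
          T a b * hafnian T (L′ ∖ b) ≈ ∑[ d ∈ L″ ∖ b ] (T a b * (T k d * hafnian T (L″ ∖ b ∖ d)))
        expand-L′∖b {b} b∈L″ = begin
          T a b * hafnian T (L′ ∖ b)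
            ≈⟨ *-congˡ (within n (≤-trans (length-∖-≤ b L′) |L′|≤n) (Unique-∖ b uL′) k∈L′∖b) ⟩
          T a b * hafnian T (k ∷ L′ ∖ b ∖ k)
            ≡⟨ ≡.cong (λ M → T a b * hafnian T (k ∷ M)) (∖-comm b k L′) ⟩
          T a b * hafnian T (k ∷ L″ ∖ b)
            ≈⟨ *-congˡ (hafnian-∷ T k (L″ ∖ b)) ⟩
          T a b * ∑[ d ∈ L″ ∖ b ] (T k d * hafnian T (L″ ∖ b ∖ d))
            ≈⟨ *-distribˡ-∑ (T a b) _ (L″ ∖ b) ⟩
          ∑[ d ∈ L″ ∖ b ] (T a b * (T k d * hafnian T (L″ ∖ b ∖ d))) ∎
          where
          k∈L′∖b = ∈-∖⁺ k∈L′ (∈-∖⇒≢ L′ b∈L″ ∘ ≡.sym)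
        collect-a : ∀ {b} → b ∈ L″ →
          ∑[ d ∈ L″ ∖ b ] (T a d * (T k b * hafnian T (L″ ∖ d ∖ b))) ≈ T k b * hafnian T ((a ∷ L″) ∖ b)
        collect-a {b} b∈L″ = begin
          ∑[ d ∈ L″ ∖ b ] (T a d * (T k b * hafnian T (L″ ∖ d ∖ b)))
            ≈⟨ ∑-cong (L″ ∖ b) (λ {d} _ → trans (x*yz≈y*xz _ _ _)
                 (*-congˡ (*-congˡ (reflexive (≡.cong (hafnian T) (∖-comm d b L″)))))) ⟩
          ∑[ d ∈ L″ ∖ b ] (T k b * (T a d * hafnian T (L″ ∖ b ∖ d)))
            ≈⟨ *-distribˡ-∑ (T k b) _ (L″ ∖ b) ⟨
          T k b * ∑[ d ∈ L″ ∖ b ] (T a d * hafnian T (L″ ∖ b ∖ d))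
            ≈⟨ *-congˡ (hafnian-∷ T a (L″ ∖ b)) ⟨
          T k b * hafnian T (a ∷ L″ ∖ b)
            ≡⟨ ≡.cong (λ M → T k b * hafnian T M) (∖-∷-≢ L″ (a∉L″ ∘ (λ a≡b → ≡.subst (_∈ L″) (≡.sym a≡b) b∈L″))) ⟨
          T k b * hafnian T ((a ∷ L″) ∖ b) ∎

module MatchingSumCharacteristic2 {c ℓ} (R : CommutativeSemiring c ℓ) (char2 : Characteristic2 R)
                                  {i} {I : Set i} (_≟_ : DecidableEquality I) where

  open CommutativeSemiring R hiding (zero)
  open SemiringSum R
  open DeletionSum +-commutativeMonoid _≟_
  open Characteristic2Properties R char2
  open Deletion _≟_
  open MatchingSum R _≟_
  open import Algebra.Properties.CommutativeSemigroup *-commutativeSemigroup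
    using () renaming (x∙yz≈y∙xz to x*yz≈y*xz)
  open import Relation.Binary.Reasoning.Setoid setoid

  pairSum-symmetric : ∀ (f : I → I → Carrier) {L} → Unique L → (∀ b d → f b d ≈ f d b) →
                      pairSum f L ≈ 0#
  pairSum-symmetric f {[]}    uL f-sym = refl
  pairSum-symmetric f {a ∷ L} uL@(_ ∷ uL′) f-sym = begin
    pairSum f (a ∷ L)
      ≈⟨ pairSum-∷ f uL ⟩
    ∑[ d ∈ L ] f a d + (∑[ b ∈ L ] f b a + pairSum f L)
      ≈⟨ +-congˡ (+-cong (∑-cong L (λ {b} _ → f-sym b a)) (pairSum-symmetric f uL′ f-sym)) ⟩
    ∑[ d ∈ L ] f a d + (∑[ d ∈ L ] f a d + 0#)
      ≈⟨ +-congˡ (+-identityʳ _) ⟩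
    ∑[ d ∈ L ] f a d + ∑[ d ∈ L ] f a d
      ≈⟨ char2 _ ⟩
    0# ∎

  hafnian-square : ∀ T L → hafnian T L ² ≈ hafnian (λ a b → T a b ²) L
  hafnian-square T L = within (length L) L
    where
    T² = λ a b → T a b ²
    within : ∀ n L → matchingSumWithin n (λ _ → 0#) T L ² ≈ matchingSumWithin n (λ _ → 0#) T² L
    within _       []      = *-identityˡ 1#
    within zero    (a ∷ L) = zeroˡ 0#
    within (suc n) (a ∷ L) = begin
      (0# * M n L + ∑[ b ∈ L ] (T a b * M n (L ∖ b))) ²
        ≈⟨ square-+ _ _ ⟩
      (0# * M n L) ² + (∑[ b ∈ L ] (T a b * M n (L ∖ b))) ²
        ≈⟨ +-cong (trans (*-cong (zeroˡ _) (zeroˡ _)) (trans (zeroˡ 0#) (sym (zeroˡ _)))) (∑-square _ L) ⟩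
      0# * M² n L + ∑[ b ∈ L ] ((T a b * M n (L ∖ b)) ²)
        ≈⟨ +-congˡ (∑-cong L λ {b} _ → trans (square-* _ _) (*-congˡ (within n (L ∖ b)))) ⟩
      0# * M² n L + ∑[ b ∈ L ] (T a b ² * M² n (L ∖ b)) ∎
      where
      M M² : ℕ → List I → Carrier
      M n  = matchingSumWithin n (λ _ → 0#) T
      M² n = matchingSumWithin n (λ _ → 0#) T²

  module _ (T : I → I → Carrier) (T-sym : ∀ a b → T a b ≈ T b a) (T-diag : ∀ a → T a a ≈ 0#) where

    hafnian-repeated : ∀ {a M} → Unique M → a ∈ M → hafnian T (a ∷ M) ≈ 0#
    hafnian-repeated {a} {M} uM a∈M = begin
      hafnian T (a ∷ M)
        ≈⟨ hafnian-∷ T a M ⟩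
      ∑[ b ∈ M ] (T a b * hafnian T (M ∖ b))
        ≈⟨ ∑-remove _ uM a∈M ⟩
      T a a * hafnian T M₁ + ∑[ b ∈ M₁ ] (T a b * hafnian T (M ∖ b))
        ≈⟨ +-cong (trans (*-congʳ (T-diag a)) (zeroˡ _)) (∑-cong M₁ expand-at-a) ⟩
      0# + pairSum (λ b d → T a b * (T a d * hafnian T (M₁ ∖ b ∖ d))) M₁
        ≈⟨ +-identityˡ _ ⟩
      pairSum (λ b d → T a b * (T a d * hafnian T (M₁ ∖ b ∖ d))) M₁
        ≈⟨ pairSum-symmetric _ (Unique-∖ a uM) summand-symmetric ⟩
      0# ∎
      where
      M₁ = M ∖ a
      expand-at-a : ∀ {b} → b ∈ M₁ →
        T a b * hafnian T (M ∖ b) ≈ ∑[ d ∈ M₁ ∖ b ] (T a b * (T a d * hafnian T (M₁ ∖ b ∖ d)))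
      expand-at-a {b} b∈M₁ = begin
        T a b * hafnian T (M ∖ b)
          ≈⟨ *-congˡ (hafnian-bringToFront T T-sym (Unique-∖ b uM) (∈-∖⁺ a∈M (∈-∖⇒≢ M b∈M₁ ∘ ≡.sym))) ⟩
        T a b * hafnian T (a ∷ M ∖ b ∖ a)
          ≡⟨ ≡.cong (λ N → T a b * hafnian T (a ∷ N)) (∖-comm b a M) ⟩
        T a b * hafnian T (a ∷ M₁ ∖ b)
          ≈⟨ *-congˡ (hafnian-∷ T a (M₁ ∖ b)) ⟩
        T a b * ∑[ d ∈ M₁ ∖ b ] (T a d * hafnian T (M₁ ∖ b ∖ d))
          ≈⟨ *-distribˡ-∑ (T a b) _ (M₁ ∖ b) ⟩
        ∑[ d ∈ M₁ ∖ b ] (T a b * (T a d * hafnian T (M₁ ∖ b ∖ d))) ∎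
      summand-symmetric : ∀ b d → T a b * (T a d * hafnian T (M₁ ∖ b ∖ d)) ≈ T a d * (T a b * hafnian T (M₁ ∖ d ∖ b))
      summand-symmetric b d = trans (x*yz≈y*xz _ _ _)
                            (*-congˡ (*-congˡ (reflexive (≡.cong (hafnian T) (∖-comm b d M₁)))))

  module _ (x : Carrier) (c : I → I → Carrier) where

    private
      F : List I → Carrier
      F = matchingSum (λ _ → x) c

    matchingSum-oddLength : ∀ m {L} → Unique L → length L ≡ suc (2 ℕ.* m) →
      matchingSum (λ _ → x) c L ≈ x * ∑[ b ∈ L ] matchingSum (λ _ → x) c (L ∖ b)

    matchingSum-oddLength-∖ : ∀ m {L b} → Unique L → length L ≡ 2 ℕ.* m → b ∈ L →
      matchingSum (λ _ → x) c (L ∖ b) ≈ x * ∑[ d ∈ L ∖ b ] matchingSum (λ _ → x) c (L ∖ b ∖ d)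
    matchingSum-oddLength-∖ zero    {[]}    _  _  ()
    matchingSum-oddLength-∖ zero    {_ ∷ _} _  () _
    matchingSum-oddLength-∖ (suc m) {L} {b} uL |L| b∈L = matchingSum-oddLength m (Unique-∖ b uL)
      (suc-injective (≡.trans (length-∖ uL b∈L) (≡.trans |L| (*-suc 2 m))))

    ∑-matchingSum-∖-evenLength : ∀ m {L} → Unique L → length L ≡ 2 ℕ.* m →
      ∑[ b ∈ L ] matchingSum (λ _ → x) c (L ∖ b) ≈ 0#
    ∑-matchingSum-∖-evenLength m {L} uL |L| = begin
      ∑[ b ∈ L ] F (L ∖ b)                       ≈⟨ ∑-cong L (matchingSum-oddLength-∖ m uL |L|) ⟩
      ∑[ b ∈ L ] (x * ∑[ d ∈ L ∖ b ] F (L ∖ b ∖ d)) ≈⟨ *-distribˡ-∑ x _ L ⟨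
      x * pairSum (λ b d → F (L ∖ b ∖ d)) L
        ≈⟨ *-congˡ (pairSum-symmetric _ uL (λ b d → reflexive (≡.cong F (∖-comm b d L)))) ⟩
      x * 0#
        ≈⟨ zeroʳ x ⟩
      0# ∎

    matchingSum-oddLength m {a ∷ L} uL@(_ ∷ uL′) |aL| = sym (begin
      x * ∑[ b ∈ a ∷ L ] F ((a ∷ L) ∖ b)
        ≈⟨ *-congˡ (+-cong (reflexive (≡.cong F (∖-head (head∉tail uL))))
                           (∑-cong L λ b∈L → reflexive (≡.cong F (∖-∷-≢ L (head≢tail uL b∈L))))) ⟩
      x * (F L + ∑[ b ∈ L ] F (a ∷ L ∖ b))
        ≈⟨ *-congˡ (+-congˡ (∑-cong L λ {b} _ → matchingSum-∷ _ c a (L ∖ b))) ⟩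
      x * (F L + ∑[ b ∈ L ] (x * F (L ∖ b) + ∑[ d ∈ L ∖ b ] (c a d * F (L ∖ b ∖ d))))
        ≈⟨ *-congˡ (+-congˡ (trans (∑-distrib-+ _ _ L) (+-congʳ a-unmatched))) ⟩
      x * (F L + (0# + pairSum (λ b d → c a d * F (L ∖ b ∖ d)) L))
        ≈⟨ trans (*-congˡ (+-congˡ (+-identityˡ _))) (distribˡ x _ _) ⟩
      x * F L + x * pairSum (λ b d → c a d * F (L ∖ b ∖ d)) L
        ≈⟨ +-congˡ a-matched ⟩
      x * F L + ∑[ b ∈ L ] (c a b * F (L ∖ b))
        ≈⟨ matchingSum-∷ _ c a L ⟨
      F (a ∷ L) ∎)
      where
      |L| = suc-injective |aL|
      a-unmatched : ∑[ b ∈ L ] (x * F (L ∖ b)) ≈ 0#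
      a-unmatched = trans (sym (*-distribˡ-∑ x _ L))
        (trans (*-congˡ (∑-matchingSum-∖-evenLength m uL′ |L|)) (zeroʳ x))
      a-matched : x * pairSum (λ b d → c a d * F (L ∖ b ∖ d)) L ≈ ∑[ b ∈ L ] (c a b * F (L ∖ b))
      a-matched = begin
        x * pairSum (λ b d → c a d * F (L ∖ b ∖ d)) L
          ≈⟨ *-congˡ (pairSum-transpose _ uL′) ⟩
        x * pairSum (λ b d → c a b * F (L ∖ d ∖ b)) L
          ≈⟨ *-distribˡ-∑ x _ L ⟩
        ∑[ b ∈ L ] (x * ∑[ d ∈ L ∖ b ] (c a b * F (L ∖ d ∖ b)))
          ≈⟨ ∑-cong L (λ {b} b∈L → *-congˡ (trans (∑-cong (L ∖ b) λ {d} _ → *-congˡ (reflexive (≡.cong F (∖-comm d b L))))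
                                                  (sym (*-distribˡ-∑ (c a b) _ (L ∖ b))))) ⟩
        ∑[ b ∈ L ] (x * (c a b * ∑[ d ∈ L ∖ b ] F (L ∖ b ∖ d)))
          ≈⟨ ∑-cong L (λ {b} b∈L → trans (x*yz≈y*xz x (c a b) _) (*-congˡ (sym (matchingSum-oddLength-∖ m uL′ |L| b∈L)))) ⟩
        ∑[ b ∈ L ] (c a b * F (L ∖ b)) ∎

    hafnian-evenLength : ∀ m {L} → Unique L → length L ≡ 2 ℕ.* m →
      hafnian (λ a b → x * x + c a b) L ≈ matchingSum (λ _ → x) c L
    hafnian-evenLength zero    {[]}    _  _ = refl
    hafnian-evenLength (suc m) {a ∷ L} uL@(_ ∷ uL′) |aL| = begin
      hafnian K (a ∷ L)
        ≈⟨ hafnian-∷ K a L ⟩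
      ∑[ b ∈ L ] ((x * x + c a b) * hafnian K (L ∖ b))
        ≈⟨ ∑-cong L (λ {b} b∈L → *-congˡ (hafnian-evenLength m (Unique-∖ b uL′)
                       (suc-injective (≡.trans (length-∖ uL′ b∈L) |L|)))) ⟩
      ∑[ b ∈ L ] ((x * x + c a b) * F (L ∖ b))
        ≈⟨ ∑-cong L (λ _ → distribʳ _ _ _) ⟩
      ∑[ b ∈ L ] (x * x * F (L ∖ b) + c a b * F (L ∖ b))
        ≈⟨ ∑-distrib-+ _ _ L ⟩
      ∑[ b ∈ L ] (x * x * F (L ∖ b)) + ∑[ b ∈ L ] (c a b * F (L ∖ b))
        ≈⟨ +-congʳ (*-distribˡ-∑ (x * x) _ L) ⟨
      x * x * ∑[ b ∈ L ] F (L ∖ b) + ∑[ b ∈ L ] (c a b * F (L ∖ b))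
        ≈⟨ +-congʳ (trans (*-assoc x x _) (*-congˡ (sym (matchingSum-oddLength m uL′ |L|)))) ⟩
      x * F L + ∑[ b ∈ L ] (c a b * F (L ∖ b))
        ≈⟨ matchingSum-∷ _ c a L ⟨
      F (a ∷ L) ∎
      where
      K = λ a b → x * x + c a b
      |L| = suc-injective (≡.trans |aL| (*-suc 2 m))

  module _ (T : I → I → Carrier) (T-sym : ∀ a b → T a b ≈ T b a) where

    open Permanent R

    -- Expanding along the first row and column, the terms off the diagonal cancel in pairs.
    permanent-symmetric : ∀ {m} (f : Fin m → I) → (∀ {r s} → f r ≡ f s → r ≡ s) →
      permanent (λ r s → T (f r) (f s)) ≈ matchingSum (λ a → T a a) (λ a b → T a b ²) (tabulate f)
    permanent-symmetric {zero}        f f-inj = refl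
    permanent-symmetric {suc zero}    f f-inj = refl
    permanent-symmetric {suc (suc m)} f f-inj = begin
      permanent M
        ≈⟨ permanent-expandFirstRowAndColumn M ⟩
      T f₀ f₀ * permanent (firstRowMinor M zero) + ∑[ i ∈ J ] ∑[ j ∈ J ] (T (f (suc i)) f₀ * (T f₀ (f (suc j)) * permanent (D i j)))
        ≈⟨ +-cong (*-congˡ (permanent-symmetric (f ∘ suc) f∘suc-inj)) (∑-cong J λ _ → ∑-cong J λ _ → *-congʳ (T-sym _ _)) ⟩
      T f₀ f₀ * S (tabulate (f ∘ suc)) + ∑[ i ∈ J ] ∑[ j ∈ J ] g i j
        ≈⟨ +-congˡ (∑∑-symmetric g J g-sym) ⟩
      T f₀ f₀ * S (tabulate (f ∘ suc)) + ∑[ i ∈ J ] g i i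
        ≈⟨ +-congˡ (∑-cong J λ {i} _ → trans (sym (*-assoc _ _ _)) (*-congˡ (diagonal-minor i))) ⟩
      T f₀ f₀ * S (tabulate (f ∘ suc)) + ∑[ i ∈ J ] (T f₀ (f (suc i)) ² * S (tabulate (f ∘ suc) ∖ f (suc i)))
        ≡⟨ ≡.cong (T f₀ f₀ * S (tabulate (f ∘ suc)) +_)
             (∑-tabulate (λ b → T f₀ b ² * S (tabulate (f ∘ suc) ∖ b)) (f ∘ suc)) ⟨
      T f₀ f₀ * S (tabulate (f ∘ suc)) + ∑[ b ∈ tabulate (f ∘ suc) ] (T f₀ b ² * S (tabulate (f ∘ suc) ∖ b))
        ≈⟨ matchingSum-∷ _ _ f₀ (tabulate (f ∘ suc)) ⟨
      S (tabulate f) ∎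
      where
      f₀ = f zero
      J = allFin (suc m)
      S = matchingSum (λ a → T a a) (λ a b → T a b ²)
      M : Matrix (suc (suc m))
      M r s = T (f r) (f s)
      D = doubleMinor M
      g : Fin (suc m) → Fin (suc m) → Carrier
      g i j = T f₀ (f (suc i)) * (T f₀ (f (suc j)) * permanent (D i j))
      f∘suc-inj : ∀ {r s} → f (suc r) ≡ f (suc s) → r ≡ s
      f∘suc-inj = Fin.suc-injective ∘ f-inj
      g-sym : ∀ i j → g i j ≈ g j i
      g-sym i j = trans (x*yz≈y*xz _ _ _) (*-congˡ (*-congˡ (begin
        permanent (D i j)      ≈⟨ permanent-transpose (D i j) ⟨
        permanent (D i j ᵀ)    ≈⟨ permanent-cong {M = D i j ᵀ} (λ r s → T-sym _ _) ⟩
        permanent (D j i)      ∎)))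
      diagonal-minor : ∀ i → permanent (D i i) ≈ S (tabulate (f ∘ suc) ∖ f (suc i))
      diagonal-minor i = begin
        permanent (D i i)
          ≈⟨ permanent-symmetric (f ∘ suc ∘ punchIn i) (Fin.punchIn-injective i _ _ ∘ f∘suc-inj) ⟩
        S (tabulate (f ∘ suc ∘ punchIn i))
          ≡⟨ ≡.cong S (∖-tabulate (f ∘ suc) f∘suc-inj i) ⟨
        S (tabulate (f ∘ suc) ∖ f (suc i)) ∎

module HafnianCramer {c ℓ m ℓm} (R : CommutativeSemiring c ℓ) (char2 : Characteristic2 R)
                     {i} {I : Set i} (_≟_ : DecidableEquality I)
                     (M : LeftSemimodule (CommutativeSemiring.semiring R) m ℓm) where

  open CommutativeSemiring R hiding (zero)
  open LeftSemimodule M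
  open Deletion _≟_
  open MatchingSum R _≟_
  open MatchingSumCharacteristic2 R char2 _≟_
  open ModuleSum R M
  open DeletionSum +ᴹ-commutativeMonoid _≟_ using (∑-remove)
  open import Relation.Binary.Reasoning.Setoid ≈ᴹ-setoid

  hafnian-∷-*ₗ : ∀ T a N u → hafnian T (a ∷ N) *ₗ u ≈ᴹ ∑[ b ∈ N ] (hafnian T (N ∖ b) *ₗ (T a b *ₗ u))
  hafnian-∷-*ₗ T a N u = begin
    hafnian T (a ∷ N) *ₗ u
      ≈⟨ *ₗ-congʳ (hafnian-∷ T a N) ⟩
    Scalar.sumOver (λ b → T a b * hafnian T (N ∖ b)) N *ₗ u
      ≈⟨ *ₗ-distribʳ-∑ _ u N ⟩
    ∑[ b ∈ N ] ((T a b * hafnian T (N ∖ b)) *ₗ u)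
      ≈⟨ ∑-cong N (λ _ → ≈ᴹ-trans (*ₗ-congʳ (*-comm _ _)) (*ₗ-assoc _ _ u)) ⟩
    ∑[ b ∈ N ] (hafnian T (N ∖ b) *ₗ (T a b *ₗ u)) ∎

  module _ (T : I → I → Carrier) (T-sym : ∀ a b → T a b ≈ T b a) (T-diag : ∀ a → T a a ≈ 0#) where

    -- Row a of T against the cofactors of row k gives hafnian L if a = k, and otherwise a
    -- hafnian with a repeated index, which vanishes.
    hafnian-cramer : ∀ {k L} → Unique L → k ∈ L → (u : I → Carrierᴹ) →
      hafnian T L *ₗ u k ≈ᴹ ∑[ b ∈ L ∖ k ] (hafnian T (L ∖ k ∖ b) *ₗ ∑[ a ∈ L ] (T a b *ₗ u a))
    hafnian-cramer {k} {L} uL k∈L u = begin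
      hafnian T L *ₗ u k
        ≈⟨ *ₗ-congʳ (hafnian-bringToFront T T-sym uL k∈L) ⟩
      hafnian T (k ∷ L ∖ k) *ₗ u k
        ≈⟨ +ᴹ-identityʳ _ ⟨
      hafnian T (k ∷ L ∖ k) *ₗ u k +ᴹ 0ᴹ
        ≈⟨ +ᴹ-congˡ (∑-zero (L ∖ k) other-rows-vanish) ⟨
      hafnian T (k ∷ L ∖ k) *ₗ u k +ᴹ ∑[ a ∈ L ∖ k ] (hafnian T (a ∷ L ∖ k) *ₗ u a)
        ≈⟨ ∑-remove (λ a → hafnian T (a ∷ L ∖ k) *ₗ u a) uL k∈L ⟨
      ∑[ a ∈ L ] (hafnian T (a ∷ L ∖ k) *ₗ u a)
        ≈⟨ ∑-cong L (λ {a} _ → hafnian-∷-*ₗ T a (L ∖ k) (u a)) ⟩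
      ∑[ a ∈ L ] ∑[ b ∈ L ∖ k ] (hafnian T (L ∖ k ∖ b) *ₗ (T a b *ₗ u a))
        ≈⟨ ∑-comm _ L (L ∖ k) ⟩
      ∑[ b ∈ L ∖ k ] ∑[ a ∈ L ] (hafnian T (L ∖ k ∖ b) *ₗ (T a b *ₗ u a))
        ≈⟨ ∑-cong (L ∖ k) (λ {b} _ → *ₗ-distribˡ-∑ (hafnian T (L ∖ k ∖ b)) _ L) ⟨
      ∑[ b ∈ L ∖ k ] (hafnian T (L ∖ k ∖ b) *ₗ ∑[ a ∈ L ] (T a b *ₗ u a)) ∎
      where
      other-rows-vanish : ∀ {a} → a ∈ L ∖ k → hafnian T (a ∷ L ∖ k) *ₗ u a ≈ᴹ 0ᴹ
      other-rows-vanish a∈L∖k =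
        ≈ᴹ-trans (*ₗ-congʳ (hafnian-repeated T T-sym T-diag (Unique-∖ k uL) a∈L∖k)) (*ₗ-zeroˡ _)

-- The polynomial ring F₂[x]

coeff-+P : ∀ p q i → coeff (p +P q) i ≡ coeff p i xor coeff q i
coeff-+P []      q       i       = ≡.refl
coeff-+P (a ∷ p) []      i       = ≡.sym (xor-identityʳ _)
coeff-+P (a ∷ p) (b ∷ q) zero    = ≡.refl
coeff-+P (a ∷ p) (b ∷ q) (suc i) = coeff-+P p q i

coeff-scaleP : ∀ a p i → coeff (scaleP a p) i ≡ a ∧ coeff p i
coeff-scaleP a []      i       = ≡.sym (∧-zeroʳ a)
coeff-scaleP a (b ∷ p) zero    = ≡.refl
coeff-scaleP a (b ∷ p) (suc i) = coeff-scaleP a p i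

infix 4 _≃_

-- _≈P_ wrapped in a record, so that the polynomials can be recovered by unification.
record _≃_ (p q : Poly) : Set where
  constructor coefficientwise
  field coefficient : p ≈P q

open _≃_

≃-isEquivalence : IsEquivalence _≃_
≃-isEquivalence = record
  { refl  = coefficientwise λ i → ≡.refl
  ; sym   = λ p≃q → coefficientwise λ i → ≡.sym (coefficient p≃q i)
  ; trans = λ p≃q q≃r → coefficientwise λ i → ≡.trans (coefficient p≃q i) (coefficient q≃r i)
  }

open IsEquivalence ≃-isEquivalence using () renaming (refl to ≃-refl; sym to ≃-sym; trans to ≃-trans)

≃-setoid : Setoid 0ℓ 0ℓ
≃-setoid = record { isEquivalence = ≃-isEquivalence }

module ≃-Reasoning = Relation.Binary.Reasoning.Setoid ≃-setoid

∷-cong : ∀ {a b p q} → a ≡ b → p ≃ q → (a ∷ p) ≃ (b ∷ q)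
∷-cong a≡b p≃q = coefficientwise λ { zero → a≡b ; (suc i) → coefficient p≃q i }

+P-cong : ∀ {p p′ q q′} → p ≃ p′ → q ≃ q′ → (p +P q) ≃ (p′ +P q′)
+P-cong {p} {p′} {q} {q′} p≃p′ q≃q′ = coefficientwise λ i →
  ≡.trans (coeff-+P p q i) (≡.trans (≡.cong₂ _xor_ (coefficient p≃p′ i) (coefficient q≃q′ i)) (≡.sym (coeff-+P p′ q′ i)))

+P-assoc : ∀ p q r → ((p +P q) +P r) ≃ (p +P (q +P r))
+P-assoc p q r = coefficientwise λ i → begin
  coeff ((p +P q) +P r) i
    ≡⟨ ≡.trans (coeff-+P (p +P q) r i) (≡.cong (_xor coeff r i) (coeff-+P p q i)) ⟩
  (coeff p i xor coeff q i) xor coeff r i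
    ≡⟨ xor-assoc (coeff p i) _ _ ⟩
  coeff p i xor (coeff q i xor coeff r i)
    ≡⟨ ≡.trans (coeff-+P p (q +P r) i) (≡.cong (coeff p i xor_) (coeff-+P q r i)) ⟨
  coeff (p +P (q +P r)) i ∎
  where open ≡.≡-Reasoning

+P-comm : ∀ p q → (p +P q) ≃ (q +P p)
+P-comm p q = coefficientwise λ i →
  ≡.trans (coeff-+P p q i) (≡.trans (xor-comm (coeff p i) _) (≡.sym (coeff-+P q p i)))

+P-self : ∀ p → (p +P p) ≃ []
+P-self p = coefficientwise λ i → ≡.trans (coeff-+P p p i) (xor-same (coeff p i))

+P-identityʳ : ∀ p → (p +P []) ≃ p
+P-identityʳ p = coefficientwise λ i → ≡.trans (coeff-+P p [] i) (xor-identityʳ (coeff p i))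

+P-isCommutativeMonoid : IsCommutativeMonoid _≃_ _+P_ []
+P-isCommutativeMonoid = isCommutativeMonoidˡ record
  { isSemigroup = record
    { isMagma = record { isEquivalence = ≃-isEquivalence ; ∙-cong = +P-cong }
    ; assoc   = +P-assoc
    }
  ; identityˡ = λ p → ≃-refl
  ; comm      = +P-comm
  }

+P-commutativeMonoid : CommutativeMonoid 0ℓ 0ℓ
+P-commutativeMonoid = record { isCommutativeMonoid = +P-isCommutativeMonoid }

open import Algebra.Properties.CommutativeSemigroup (CommutativeMonoid.commutativeSemigroup +P-commutativeMonoid)
  using (interchange; x∙yz≈y∙xz)

scaleP-cong : ∀ a {p q} → p ≃ q → scaleP a p ≃ scaleP a q
scaleP-cong a {p} {q} p≃q = coefficientwise λ i →
  ≡.trans (coeff-scaleP a p i) (≡.trans (≡.cong (a ∧_) (coefficient p≃q i)) (≡.sym (coeff-scaleP a q i)))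

scaleP-false : ∀ p → scaleP false p ≃ []
scaleP-false p = coefficientwise (coeff-scaleP false p)

scaleP-xor : ∀ a b p → scaleP (a xor b) p ≃ (scaleP a p +P scaleP b p)
scaleP-xor a b p = coefficientwise λ i → ≡.trans (coeff-scaleP (a xor b) p i) (≡.trans (∧-distribʳ-xor (coeff p i) a b)
  (≡.sym (≡.trans (coeff-+P (scaleP a p) _ i) (≡.cong₂ _xor_ (coeff-scaleP a p i) (coeff-scaleP b p i)))))

scaleP-+P : ∀ a p q → scaleP a (p +P q) ≃ (scaleP a p +P scaleP a q)
scaleP-+P a p q = coefficientwise λ i → begin
  coeff (scaleP a (p +P q)) i
    ≡⟨ ≡.trans (coeff-scaleP a (p +P q) i) (≡.cong (a ∧_) (coeff-+P p q i)) ⟩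
  a ∧ (coeff p i xor coeff q i)
    ≡⟨ ∧-distribˡ-xor a _ _ ⟩
  (a ∧ coeff p i) xor (a ∧ coeff q i)
    ≡⟨ ≡.trans (coeff-+P (scaleP a p) _ i) (≡.cong₂ _xor_ (coeff-scaleP a p i) (coeff-scaleP a q i)) ⟨
  coeff (scaleP a p +P scaleP a q) i ∎
  where open ≡.≡-Reasoning

scaleP-∧ : ∀ a b p → scaleP (a ∧ b) p ≃ scaleP a (scaleP b p)
scaleP-∧ a b p = coefficientwise λ i → ≡.trans (coeff-scaleP (a ∧ b) p i) (≡.trans (∧-assoc a b _)
  (≡.sym (≡.trans (coeff-scaleP a (scaleP b p) i) (≡.cong (a ∧_) (coeff-scaleP b p i)))))

*P-congʳ : ∀ p {q q′} → q ≃ q′ → (p *P q) ≃ (p *P q′)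
*P-congʳ []      q≃q′ = ≃-refl
*P-congʳ (a ∷ p) q≃q′ = +P-cong (scaleP-cong a q≃q′) (∷-cong ≡.refl (*P-congʳ p q≃q′))

*P-zeroʳ : ∀ p → (p *P []) ≃ []
*P-zeroʳ []      = ≃-refl
*P-zeroʳ (a ∷ p) = coefficientwise λ { zero → ≡.refl ; (suc i) → coefficient (*P-zeroʳ p) i }

*P-∷ʳ : ∀ p b q → (p *P (b ∷ q)) ≃ (scaleP b p +P (false ∷ (p *P q)))
*P-∷ʳ []      b q = coefficientwise λ { zero → ≡.refl ; (suc i) → ≡.refl }
*P-∷ʳ (a ∷ p) b q = ∷-cong (≡.trans (xor-identityʳ _) (≡.trans (∧-comm a b) (≡.sym (xor-identityʳ _)))) (begin
  scaleP a q +P (p *P (b ∷ q))                        ≈⟨ +P-cong ≃-refl (*P-∷ʳ p b q) ⟩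
  scaleP a q +P (scaleP b p +P (false ∷ (p *P q)))    ≈⟨ x∙yz≈y∙xz (scaleP a q) (scaleP b p) (false ∷ (p *P q)) ⟩
  scaleP b p +P (scaleP a q +P (false ∷ (p *P q)))    ∎)
  where open ≃-Reasoning

*P-comm : ∀ p q → (p *P q) ≃ (q *P p)
*P-comm []      q = ≃-sym (*P-zeroʳ q)
*P-comm (a ∷ p) q = ≃-trans (+P-cong ≃-refl (∷-cong ≡.refl (*P-comm p q))) (≃-sym (*P-∷ʳ q a p))

*P-congˡ : ∀ {p p′} q → p ≃ p′ → (p *P q) ≃ (p′ *P q)
*P-congˡ {p} {p′} q p≃p′ = ≃-trans (*P-comm p q) (≃-trans (*P-congʳ q p≃p′) (*P-comm q p′))

*P-cong : ∀ {p p′ q q′} → p ≃ p′ → q ≃ q′ → (p *P q) ≃ (p′ *P q′)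
*P-cong {p′ = p′} {q} p≃p′ q≃q′ = ≃-trans (*P-congˡ q p≃p′) (*P-congʳ p′ q≃q′)

*P-distribʳ : ∀ q p p′ → ((p +P p′) *P q) ≃ ((p *P q) +P (p′ *P q))
*P-distribʳ q []      p′        = ≃-refl
*P-distribʳ q (a ∷ p) []        = ≃-sym (+P-identityʳ _)
*P-distribʳ q (a ∷ p) (a′ ∷ p′) = ≃-trans
  (+P-cong (scaleP-xor a a′ q) (∷-cong ≡.refl (*P-distribʳ q p p′)))
  (interchange (scaleP a q) (scaleP a′ q) (false ∷ (p *P q)) (false ∷ (p′ *P q)))

*P-identityˡ : ∀ q → ((true ∷ []) *P q) ≃ q
*P-identityˡ q = coefficientwise λ i →
  ≡.trans (coeff-+P (scaleP true q) (false ∷ []) i)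
    (≡.trans (≡.cong₂ _xor_ (coeff-scaleP true q i) (coeff-false∷[] i)) (xor-identityʳ _))
  where
  coeff-false∷[] : ∀ i → coeff (false ∷ []) i ≡ false
  coeff-false∷[] zero    = ≡.refl
  coeff-false∷[] (suc i) = ≡.refl

scaleP-*P : ∀ a q r → (scaleP a q *P r) ≃ scaleP a (q *P r)
scaleP-*P a []      r = ≃-refl
scaleP-*P a (b ∷ q) r = begin
  scaleP (a ∧ b) r +P (false ∷ (scaleP a q *P r))
    ≈⟨ +P-cong (scaleP-∧ a b r) (∷-cong (≡.sym (∧-zeroʳ a)) (scaleP-*P a q r)) ⟩
  scaleP a (scaleP b r) +P scaleP a (false ∷ (q *P r))
    ≈⟨ scaleP-+P a (scaleP b r) (false ∷ (q *P r)) ⟨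
  scaleP a (scaleP b r +P (false ∷ (q *P r))) ∎
  where open ≃-Reasoning

*P-assoc : ∀ p q r → ((p *P q) *P r) ≃ (p *P (q *P r))
*P-assoc []      q r = ≃-refl
*P-assoc (a ∷ p) q r = ≃-trans (*P-distribʳ r (scaleP a q) (false ∷ (p *P q)))
  (+P-cong (scaleP-*P a q r) (≃-trans (+P-cong (scaleP-false r) ≃-refl) (∷-cong ≡.refl (*P-assoc p q r))))

F₂[X] : CommutativeSemiring 0ℓ 0ℓ
F₂[X] = record
  { _≈_ = _≃_ ; _+_ = _+P_ ; _*_ = _*P_ ; 0# = [] ; 1# = true ∷ []
  ; isCommutativeSemiring = isCommutativeSemiringˡ record
  { +-isCommutativeMonoid = +P-isCommutativeMonoid
  ; *-isCommutativeMonoid = isCommutativeMonoidˡ record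
    { isSemigroup = record
      { isMagma = record { isEquivalence = ≃-isEquivalence ; ∙-cong = *P-cong }
      ; assoc   = *P-assoc
      }
    ; identityˡ = *P-identityˡ
    ; comm      = *P-comm
    }
  ; distribʳ = *P-distribʳ
  ; zeroˡ    = λ p → ≃-refl {[]}
  } }

F₂[X]-characteristic2 : Characteristic2 F₂[X]
F₂[X]-characteristic2 = +P-self

X*P≃false∷ : ∀ p → (X *P p) ≃ (false ∷ p)
X*P≃false∷ p = ≃-trans (+P-cong (scaleP-false p) ≃-refl) (∷-cong ≡.refl (*P-identityˡ p))

X*P-cancel : ∀ {p q} → (X *P p) ≃ (X *P q) → p ≃ q
X*P-cancel {p} {q} Xp≃Xq = coefficientwise λ i →
  coefficient (≃-trans (≃-sym (X*P≃false∷ p)) (≃-trans Xp≃Xq (X*P≃false∷ q))) (suc i)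

spread : Poly → Poly
spread []      = []
spread (a ∷ p) = a ∷ false ∷ spread p

square≃spread : ∀ p → (p *P p) ≃ spread p
square≃spread []      = ≃-refl
square≃spread (a ∷ p) = ∷-cong (≡.trans (xor-identityʳ _) (∧-idem a)) (begin
  scaleP a p +P (p *P (a ∷ p))
    ≈⟨ +P-cong ≃-refl (*P-∷ʳ p a p) ⟩
  scaleP a p +P (scaleP a p +P (false ∷ (p *P p)))
    ≈⟨ +P-assoc (scaleP a p) _ _ ⟨
  (scaleP a p +P scaleP a p) +P (false ∷ (p *P p))
    ≈⟨ +P-cong (+P-self (scaleP a p)) (∷-cong ≡.refl (square≃spread p)) ⟩
  false ∷ spread p ∎)
  where open ≃-Reasoning

coeff-spread : ∀ p i → coeff (spread p) (i ℕ.+ i) ≡ coeff p i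
coeff-spread []      i       = ≡.refl
coeff-spread (a ∷ p) zero    = ≡.refl
coeff-spread (a ∷ p) (suc i) = ≡.trans (≡.cong (coeff (spread (a ∷ p)) ∘ suc) (+-suc i i)) (coeff-spread p i)

square-injective : ∀ {p q} → (p *P p) ≃ (q *P q) → p ≃ q
square-injective {p} {q} p²≃q² = coefficientwise λ i → ≡.trans (≡.sym (coeff-spread p i))
  (≡.trans (coefficient (≃-trans (≃-sym (square≃spread p)) (≃-trans p²≃q² (square≃spread q))) (i ℕ.+ i)) (coeff-spread q i))

^P-+ : ∀ p m n → (p ^P (m ℕ.+ n)) ≃ ((p ^P m) *P (p ^P n))
^P-+ p zero    n = ≃-sym (*P-identityˡ _)
^P-+ p (suc m) n = ≃-trans (*P-congʳ p (^P-+ p m n)) (≃-sym (*P-assoc p (p ^P m) (p ^P n)))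

X^[1+2h]*P² : ∀ h p → ((X ^P suc (2 ℕ.* h)) *P (p ^P 2)) ≃ (X *P (((X ^P h) *P p) *P ((X ^P h) *P p)))
X^[1+2h]*P² h p = begin
  (X *P (X ^P (h ℕ.+ (h ℕ.+ 0)))) *P (p *P (p *P (true ∷ [])))
    ≈⟨ *P-cong (*P-congʳ X (≃-trans (^P-+ X h (h ℕ.+ 0)) (*P-congʳ (X ^P h) (≡⇒≃ (≡.cong (X ^P_) (ℕₚ.+-identityʳ h))))))
               (*P-congʳ p (*-identityʳ p)) ⟩
  (X *P ((X ^P h) *P (X ^P h))) *P (p *P p)
    ≈⟨ solve 3 (λ x y q → (x :* (y :* y)) :* (q :* q) := x :* ((y :* q) :* (y :* q))) ≃-refl X (X ^P h) p ⟩
  X *P (((X ^P h) *P p) *P ((X ^P h) *P p)) ∎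
  where
  open CommutativeSemiring F₂[X] using (*-identityʳ)
  open ≃-Reasoning
  open import Algebra.Solver.Ring.NaturalCoefficients.Default F₂[X] using (solve; _:*_; _:=_)
  ≡⇒≃ = IsEquivalence.reflexive ≃-isEquivalence

constP-square : ∀ c → (constP c *P constP c) ≃ constP c
constP-square c = coefficientwise λ
  { zero    → ≡.trans (xor-identityʳ (c ∧ c)) (∧-idem c)
  ; (suc i) → ≡.refl
  }

sumP≡∑ : ∀ {m} (f : Fin m → Poly) → sumP f ≡ SemiringSum.sumOver F₂[X] f (allFin m)
sumP≡∑ {zero}  f = ≡.refl
sumP≡∑ {suc m} f = ≡.cong (f zero +P_)
  (≡.trans (sumP≡∑ (f ∘ suc)) (≡.sym (SemiringSum.∑-tabulate F₂[X] f Fin.suc)))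

detP≃permanent : ∀ {m} (M : Fin m → Fin m → Poly) → detP M ≃ Permanent.permanent F₂[X] M
detP≃permanent {zero}  M = ≃-refl
detP≃permanent {suc m} M = ≃-trans (≡⇒≃ (sumP≡∑ (λ j → M zero j *P detP (minor M j))))
  (SemiringSum.∑-cong F₂[X] {f = λ j → M zero j *P detP (minor M j)} (allFin (suc m))
    λ {j} _ → *P-congʳ (M zero j) (detP≃permanent (minor M j)))
  where ≡⇒≃ = IsEquivalence.reflexive ≃-isEquivalence

-- Matrices over F₂ and the F₂[x]-module F₂ⁿ

𝔹 : CommutativeSemiring 0ℓ 0ℓ
𝔹 = CommutativeRing.commutativeSemiring xor-∧-commutativeRing

open import Algebra.Properties.CommutativeSemigroup (CommutativeSemiring.+-commutativeSemigroup 𝔹)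
  using () renaming (interchange to xor-interchange)

sumF2-cong : ∀ {m} {f g : Fin m → Bool} → (∀ l → f l ≡ g l) → sumF2 f ≡ sumF2 g
sumF2-cong {zero}  f≗g = ≡.refl
sumF2-cong {suc m} f≗g = ≡.cong₂ _xor_ (f≗g zero) (sumF2-cong (f≗g ∘ suc))

sumF2-false : ∀ m → sumF2 {m} (λ _ → false) ≡ false
sumF2-false zero    = ≡.refl
sumF2-false (suc m) = sumF2-false m

sumF2-xor : ∀ {m} (f g : Fin m → Bool) → sumF2 (λ l → f l xor g l) ≡ sumF2 f xor sumF2 g
sumF2-xor {zero}  f g = ≡.refl
sumF2-xor {suc m} f g = ≡.trans (≡.cong ((f zero xor g zero) xor_) (sumF2-xor (f ∘ suc) (g ∘ suc)))
  (xor-interchange (f zero) (g zero) _ _)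

∧-distribˡ-sumF2 : ∀ {m} a (f : Fin m → Bool) → a ∧ sumF2 f ≡ sumF2 (λ l → a ∧ f l)
∧-distribˡ-sumF2 {zero}  a f = ∧-zeroʳ a
∧-distribˡ-sumF2 {suc m} a f =
  ≡.trans (∧-distribˡ-xor a (f zero) _) (≡.cong ((a ∧ f zero) xor_) (∧-distribˡ-sumF2 a (f ∘ suc)))

∧-distribʳ-sumF2 : ∀ {m} a (f : Fin m → Bool) → sumF2 f ∧ a ≡ sumF2 (λ l → f l ∧ a)
∧-distribʳ-sumF2 a f = ≡.trans (∧-comm _ a) (≡.trans (∧-distribˡ-sumF2 a f) (sumF2-cong (λ l → ∧-comm a (f l))))

sumF2-comm : ∀ {m m′} (f : Fin m → Fin m′ → Bool) →
             sumF2 (λ l → sumF2 (f l)) ≡ sumF2 (λ l′ → sumF2 (λ l → f l l′))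
sumF2-comm {zero}  {m′} f = ≡.sym (sumF2-false m′)
sumF2-comm {suc m} {m′} f = ≡.trans (≡.cong (sumF2 (f zero) xor_) (sumF2-comm (f ∘ suc)))
                                    (≡.sym (sumF2-xor (f zero) _))

sumF2-δ : ∀ {m} (j : Fin m) (w : Fin m → Bool) → sumF2 (λ l → δ j l ∧ w l) ≡ w j
sumF2-δ {suc m} zero    w = ≡.trans (≡.cong (w zero xor_) (sumF2-false m)) (xor-identityʳ (w zero))
sumF2-δ {suc m} (suc j) w = sumF2-δ j (w ∘ suc)

δ-sym : ∀ {m} (i j : Fin m) → δ i j ≡ δ j i
δ-sym zero    zero    = ≡.refl
δ-sym zero    (suc j) = ≡.refl
δ-sym (suc i) zero    = ≡.refl
δ-sym (suc i) (suc j) = δ-sym i j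

δ-refl : ∀ {m} (i : Fin m) → δ i i ≡ true
δ-refl zero    = ≡.refl
δ-refl (suc i) = δ-refl i

δ-≢ : ∀ {m} {i j : Fin m} → i ≢ j → δ i j ≡ false
δ-≢ {i = zero}  {zero}  i≢j = contradiction ≡.refl i≢j
δ-≢ {i = zero}  {suc j} i≢j = ≡.refl
δ-≢ {i = suc i} {zero}  i≢j = ≡.refl
δ-≢ {i = suc i} {suc j} i≢j = δ-≢ (i≢j ∘ ≡.cong suc)

open import Algebra.Properties.Monoid.Mult (CommutativeSemiring.+-monoid 𝔹) using (_×_; ×-homo-+)
open Characteristic2Properties 𝔹 xor-same using (×-even; ×-odd)

sumF2-const : ∀ m x → sumF2 {m} (λ _ → x) ≡ m × x
sumF2-const zero    x = ≡.refl
sumF2-const (suc m) x = ≡.cong (x xor_) (sumF2-const m x)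

sumF2≡countTrue× : ∀ {m} (f : Fin m → Bool) → sumF2 f ≡ countTrue f × true
sumF2≡countTrue× {zero}  f = ≡.refl
sumF2≡countTrue× {suc m} f = ≡.trans (≡.cong₂ _xor_ (indicator (f zero)) (sumF2≡countTrue× (f ∘ suc)))
  (≡.sym (×-homo-+ true (if f zero then 1 else 0) (countTrue (f ∘ suc))))
  where
  indicator : ∀ b → b ≡ (if b then 1 else 0) × true
  indicator false = ≡.refl
  indicator true  = ≡.refl

sumF2-even : ∀ {m} (f : Fin m → Bool) → 2 ∣ countTrue f → sumF2 f ≡ false
sumF2-even f (divides q |f|≡q*2) =
  ≡.trans (sumF2≡countTrue× f) (≡.trans (≡.cong (_× true) (≡.trans |f|≡q*2 (ℕₚ.*-comm q 2))) (×-even q true))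

δ-column : ∀ {m} → Fin m → Vector Bool m
δ-column j l = δ l j

⊗-assoc : ∀ {m} (M N P : Mat m) i j → ((M ⊗ N) ⊗ P) i j ≡ (M ⊗ (N ⊗ P)) i j
⊗-assoc M N P i j = begin
  sumF2 (λ l → sumF2 (λ k → M i k ∧ N k l) ∧ P l j)
    ≡⟨ sumF2-cong (λ l → ∧-distribʳ-sumF2 (P l j) (λ k → M i k ∧ N k l)) ⟩
  sumF2 (λ l → sumF2 (λ k → (M i k ∧ N k l) ∧ P l j))
    ≡⟨ sumF2-comm (λ l k → (M i k ∧ N k l) ∧ P l j) ⟩
  sumF2 (λ k → sumF2 (λ l → (M i k ∧ N k l) ∧ P l j))
    ≡⟨ sumF2-cong (λ k → sumF2-cong (λ l → ∧-assoc (M i k) (N k l) (P l j))) ⟩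
  sumF2 (λ k → sumF2 (λ l → M i k ∧ (N k l ∧ P l j)))
    ≡⟨ sumF2-cong (λ k → ∧-distribˡ-sumF2 (M i k) (λ l → N k l ∧ P l j)) ⟨
  sumF2 (λ k → M i k ∧ sumF2 (λ l → N k l ∧ P l j)) ∎
  where open ≡.≡-Reasoning

module PolynomialAction {n} (A : Mat n) where

  module Pointwise = Algebra.Construct.Pointwise (Fin n)

  infixr 7 _⊙_

  A* : Vector Bool n → Vector Bool n
  A* v i = sumF2 (λ l → A i l ∧ v l)

  _⊙_ : Poly → Vector Bool n → Vector Bool n
  ([]      ⊙ v) i = false
  ((a ∷ p) ⊙ v) i = (a ∧ v i) xor A* (p ⊙ v) i

  A*-cong : ∀ {v w} → v ≗ w → A* v ≗ A* w
  A*-cong v≗w i = sumF2-cong (λ l → ≡.cong (A i l ∧_) (v≗w l))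

  A*-xor : ∀ v w i → A* (λ l → v l xor w l) i ≡ A* v i xor A* w i
  A*-xor v w i = ≡.trans (sumF2-cong (λ l → ∧-distribˡ-xor (A i l) (v l) (w l)))
    (sumF2-xor (λ l → A i l ∧ v l) (λ l → A i l ∧ w l))

  A*-false : ∀ i → A* (λ _ → false) i ≡ false
  A*-false i = ≡.trans (sumF2-cong (λ l → ∧-zeroʳ (A i l))) (sumF2-false n)

  A*-∧ : ∀ a v i → A* (λ l → a ∧ v l) i ≡ a ∧ A* v i
  A*-∧ a v i = ≡.trans (sumF2-cong (λ l → ∧-swapˡ (A i l) a (v l))) (≡.sym (∧-distribˡ-sumF2 a (λ l → A i l ∧ v l)))
    where
    ∧-swapˡ : ∀ x y z → x ∧ (y ∧ z) ≡ y ∧ (x ∧ z)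
    ∧-swapˡ x y z = ≡.trans (≡.sym (∧-assoc x y z)) (≡.trans (≡.cong (_∧ z) (∧-comm x y)) (∧-assoc y x z))

  ⊙-congʳ : ∀ p {v w} → v ≗ w → p ⊙ v ≗ p ⊙ w
  ⊙-congʳ []      v≗w i = ≡.refl
  ⊙-congʳ (a ∷ p) v≗w i = ≡.cong₂ _xor_ (≡.cong (a ∧_) (v≗w i)) (A*-cong (⊙-congʳ p v≗w) i)

  ⊙-zeroʳ : ∀ p → p ⊙ (λ _ → false) ≗ (λ _ → false)
  ⊙-zeroʳ []      i = ≡.refl
  ⊙-zeroʳ (a ∷ p) i = ≡.cong₂ _xor_ (∧-zeroʳ a) (≡.trans (A*-cong (⊙-zeroʳ p) i) (A*-false i))

  ⊙-≃[] : ∀ {p} → p ≃ [] → ∀ v → p ⊙ v ≗ (λ _ → false)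
  ⊙-≃[] {[]}    p≃[] v i = ≡.refl
  ⊙-≃[] {a ∷ p} p≃[] v i = ≡.cong₂ _xor_ (≡.cong (_∧ v i) (coefficient p≃[] zero))
    (≡.trans (A*-cong (⊙-≃[] (coefficientwise {p} {[]} (coefficient p≃[] ∘ suc)) v) i) (A*-false i))

  ⊙-congˡ : ∀ {p q} → p ≃ q → ∀ v → p ⊙ v ≗ q ⊙ v
  ⊙-congˡ {[]}    {q}     p≃q v i = ≡.sym (⊙-≃[] (≃-sym p≃q) v i)
  ⊙-congˡ {a ∷ p} {[]}    p≃q v i = ⊙-≃[] p≃q v i
  ⊙-congˡ {a ∷ p} {b ∷ q} p≃q v i = ≡.cong₂ _xor_ (≡.cong (_∧ v i) (coefficient p≃q zero))
    (A*-cong (⊙-congˡ (coefficientwise {p} {q} (coefficient p≃q ∘ suc)) v) i)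

  ⊙-distribˡ : ∀ p v w → p ⊙ (λ l → v l xor w l) ≗ (λ l → (p ⊙ v) l xor (p ⊙ w) l)
  ⊙-distribˡ []      v w i = ≡.refl
  ⊙-distribˡ (a ∷ p) v w i = ≡.trans
    (≡.cong₂ _xor_ (∧-distribˡ-xor a (v i) (w i)) (≡.trans (A*-cong (⊙-distribˡ p v w) i) (A*-xor _ _ i)))
    (xor-interchange (a ∧ v i) (a ∧ w i) _ _)

  ⊙-distribʳ : ∀ v p q → (p +P q) ⊙ v ≗ (λ l → (p ⊙ v) l xor (q ⊙ v) l)
  ⊙-distribʳ v []      q       i = ≡.refl
  ⊙-distribʳ v (a ∷ p) []      i = ≡.sym (xor-identityʳ _)
  ⊙-distribʳ v (a ∷ p) (b ∷ q) i = ≡.trans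
    (≡.cong₂ _xor_ (∧-distribʳ-xor (v i) a b) (≡.trans (A*-cong (⊙-distribʳ v p q) i) (A*-xor _ _ i)))
    (xor-interchange (a ∧ v i) (b ∧ v i) _ _)

  ⊙-scaleP : ∀ a p v → scaleP a p ⊙ v ≗ (λ l → a ∧ (p ⊙ v) l)
  ⊙-scaleP a []      v i = ≡.sym (∧-zeroʳ a)
  ⊙-scaleP a (b ∷ p) v i = ≡.trans
    (≡.cong₂ _xor_ (∧-assoc a b (v i)) (≡.trans (A*-cong (⊙-scaleP a p v) i) (A*-∧ a (p ⊙ v) i)))
    (≡.sym (∧-distribˡ-xor a _ _))

  ⊙-assoc : ∀ p q v → (p *P q) ⊙ v ≗ p ⊙ (q ⊙ v)
  ⊙-assoc []      q v i = ≡.refl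
  ⊙-assoc (a ∷ p) q v i = ≡.trans (⊙-distribʳ v (scaleP a q) (false ∷ (p *P q)) i)
    (≡.cong₂ _xor_ (⊙-scaleP a q v i) (A*-cong (⊙-assoc p q v) i))

  ⊙-identityˡ : ∀ v → (true ∷ []) ⊙ v ≗ v
  ⊙-identityˡ v i = ≡.trans (≡.cong (v i xor_) (A*-false i)) (xor-identityʳ (v i))

  F₂ⁿ : LeftSemimodule (CommutativeSemiring.semiring F₂[X]) 0ℓ 0ℓ
  F₂ⁿ = record
    { _*ₗ_             = _⊙_
    ; isLeftSemimodule = record
      { +ᴹ-isCommutativeMonoid = Pointwise.isCommutativeMonoid (CommutativeSemiring.+-isCommutativeMonoid 𝔹)
      ; isPreleftSemimodule = record
        { *ₗ-cong      = λ {p} {q} {v} {w} p≃q v≗w i → ≡.trans (⊙-congˡ p≃q v i) (⊙-congʳ q v≗w i)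
        ; *ₗ-zeroˡ     = λ v i → ≡.refl
        ; *ₗ-distribʳ  = ⊙-distribʳ
        ; *ₗ-identityˡ = ⊙-identityˡ
        ; *ₗ-assoc     = ⊙-assoc
        ; *ₗ-zeroʳ     = ⊙-zeroʳ
        ; *ₗ-distribˡ  = ⊙-distribˡ
        }
      }
    }

  module VectorSum = ModuleSum F₂[X] F₂ⁿ

  ∑ᴹ-tabulate : ∀ {k} {J : Set} (f : J → Vector Bool n) (g : Fin k → J) l →
                VectorSum.sumOver f (tabulate g) l ≡ sumF2 (λ a → f (g a) l)
  ∑ᴹ-tabulate {zero}  f g l = ≡.refl
  ∑ᴹ-tabulate {suc k} f g l = ≡.cong (f (g zero) l xor_) (∑ᴹ-tabulate f (g ∘ suc) l)

  X⊙ : ∀ v → X ⊙ v ≗ A* v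
  X⊙ v i = A*-cong (⊙-identityˡ v) i

  evalM≡⊙ : ∀ p i j → evalM p A i j ≡ (p ⊙ δ-column j) i
  evalM≡⊙ []      i j = ≡.refl
  evalM≡⊙ (a ∷ p) i j = ≡.cong ((a ∧ δ i j) xor_) (sumF2-cong (λ l → ≡.cong (A i l ∧_) (evalM≡⊙ p l j)))

  ^M-⊗ : ∀ h (N : Mat n) i j → ((A ^M h) ⊗ N) i j ≡ ((X ^P h) ⊙ (λ l → N l j)) i
  ^M-⊗ zero    N i j = ≡.trans (sumF2-δ i (λ l → N l j)) (≡.sym (⊙-identityˡ (λ l → N l j) i))
  ^M-⊗ (suc h) N i j = begin
    ((A ⊗ (A ^M h)) ⊗ N) i j                  ≡⟨ ⊗-assoc A (A ^M h) N i j ⟩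
    A* (λ l → ((A ^M h) ⊗ N) l j) i          ≡⟨ A*-cong (λ l → ^M-⊗ h N l j) i ⟩
    A* ((X ^P h) ⊙ (λ l → N l j)) i          ≡⟨ X⊙ _ i ⟨
    (X ⊙ (X ^P h) ⊙ (λ l → N l j)) i         ≡⟨ ⊙-assoc X (X ^P h) _ i ⟨
    ((X *P (X ^P h)) ⊙ (λ l → N l j)) i      ∎
    where open ≡.≡-Reasoning

  ^M-⊗-evalM : ∀ h p i j → ((A ^M h) ⊗ evalM p A) i j ≡ (((X ^P h) *P p) ⊙ δ-column j) i
  ^M-⊗-evalM h p i j = ≡.trans (^M-⊗ h (evalM p A) i j)
    (≡.trans (⊙-congʳ (X ^P h) (λ l → evalM≡⊙ p l j) i) (≡.sym (⊙-assoc (X ^P h) p (δ-column j) i)))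

-- The bordered hafnian of an Eulerian graph

module BorderedHafnian {n} (G : Graph n) (even-degree : ∀ v → 2 ∣ degree G v)
                       (m : ℕ) (n≡ : n ≡ suc (2 ℕ.* m)) where

  A : Mat n
  A = adjMatrix G

  open PolynomialAction A
  open CommutativeSemiring F₂[X] using (_*_; _+_; *-identityˡ)
  open SemiringSum F₂[X]
  open Characteristic2Properties F₂[X] F₂[X]-characteristic2 using (_²; square-+; ∑-square)
  open Deletion (Fin._≟_ {suc n})
  open MatchingSum F₂[X] (Fin._≟_ {suc n})
  open MatchingSumCharacteristic2 F₂[X] F₂[X]-characteristic2 (Fin._≟_ {suc n})
  open Permanent F₂[X] using (permanent)
  module Cramer = HafnianCramer F₂[X] F₂[X]-characteristic2 (Fin._≟_ {suc n}) F₂ⁿ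

  Â : Fin (suc n) → Fin (suc n) → Bool
  Â (suc a) (suc b) = A a b
  Â _       _       = false

  -- xI + A, bordered by zeros: its restriction to V is the matrix of charPoly A.
  C : Fin (suc n) → Fin (suc n) → Poly
  C a b = (if δ a b then X else []) +P constP (Â a b)

  S : Fin (suc n) → Fin (suc n) → Poly
  S zero    zero    = []
  S zero    (suc b) = true ∷ []
  S (suc a) zero    = true ∷ []
  S (suc a) (suc b) = (X +P constP (A a b)) +P scaleP (δ a b) X

  V : List (Fin (suc n))
  V = tabulate suc

  Ψ : Poly
  Ψ = hafnian S (zero ∷ V)

  Unique-V : Unique V
  Unique-V = Unique.tabulate⁺ Fin.suc-injective

  length-V : length V ≡ suc (2 ℕ.* m)
  length-V = ≡.trans (length-tabulate suc) n≡

  length-V∖ : ∀ {b} → b ∈ V → length (V ∖ b) ≡ 2 ℕ.* m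
  length-V∖ b∈V = suc-injective (≡.trans (length-∖ Unique-V b∈V) length-V)

  Â-sym : ∀ a b → Â a b ≡ Â b a
  Â-sym zero    zero    = ≡.refl
  Â-sym zero    (suc b) = ≡.refl
  Â-sym (suc a) zero    = ≡.refl
  Â-sym (suc a) (suc b) = symmetric G a b

  C-sym : ∀ a b → C a b ≃ C b a
  C-sym a b rewrite δ-sym a b | Â-sym a b = ≃-refl

  C-diagonal : ∀ {a} → a ∈ V → C a a ≃ X
  C-diagonal a∈V with ∈-tabulate⁻ a∈V
  ... | i , ≡.refl rewrite δ-refl i | loopless G i = ≃-refl

  C-offdiagonal² : ∀ {a b} → a ∈ V → b ∈ V → a ≢ b → C a b ² ≃ constP (Â a b)
  C-offdiagonal² a∈V b∈V a≢b with ∈-tabulate⁻ a∈V | ∈-tabulate⁻ b∈V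
  ... | i , ≡.refl | j , ≡.refl rewrite δ-≢ (a≢b ∘ ≡.cong suc) = constP-square (A i j)

  S-offdiagonal² : ∀ {a b} → a ∈ V → b ∈ V → a ≢ b → X * X + constP (Â a b) ≃ S a b ²
  S-offdiagonal² a∈V b∈V a≢b with ∈-tabulate⁻ a∈V | ∈-tabulate⁻ b∈V
  ... | i , ≡.refl | j , ≡.refl rewrite δ-≢ (a≢b ∘ ≡.cong suc) = ≃-sym (begin
    ((X +P constP (A i j)) +P scaleP false X) ²  ≈⟨ *P-cong S≃ S≃ ⟩
    (X +P constP (A i j)) ²                       ≈⟨ square-+ X (constP (A i j)) ⟩
    X ² + constP (A i j) ²                        ≈⟨ +P-cong (≃-refl {X ²}) (constP-square (A i j)) ⟩
    X * X + constP (A i j)                        ∎)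
    where
    open ≃-Reasoning
    S≃ : ((X +P constP (A i j)) +P scaleP false X) ≃ (X +P constP (A i j))
    S≃ = ≃-trans (+P-cong (≃-refl {X +P constP (A i j)}) (scaleP-false X)) (+P-identityʳ (X +P constP (A i j)))

  Ψ≃∑-hafnian : Ψ ≃ ∑[ b ∈ V ] hafnian S (V ∖ b)
  Ψ≃∑-hafnian = ≃-trans (hafnian-∷ S zero V) (∑-cong V λ b∈V → border-row b∈V)
    where
    border-row : ∀ {b} → b ∈ V → S zero b * hafnian S (V ∖ b) ≃ hafnian S (V ∖ b)
    border-row b∈V with ∈-tabulate⁻ b∈V
    ... | j , ≡.refl = *-identityˡ _

  charPoly≃X*Ψ² : charPoly A ≃ X * Ψ ²
  charPoly≃X*Ψ² = begin
    charPoly A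
      ≈⟨ detP≃permanent (λ r s → C (suc r) (suc s)) ⟩
    permanent (λ r s → C (suc r) (suc s))
      ≈⟨ permanent-symmetric C C-sym suc Fin.suc-injective ⟩
    matchingSum (λ a → C a a) (λ a b → C a b ²) V
      ≈⟨ matchingSum-cong Unique-V C-diagonal C-offdiagonal² ⟩
    matchingSum (λ _ → X) c V
      ≈⟨ matchingSum-oddLength X c m Unique-V length-V ⟩
    X * ∑[ b ∈ V ] matchingSum (λ _ → X) c (V ∖ b)
      ≈⟨ *P-congʳ X (∑-cong V λ b∈V → ≃-sym (hafnian-evenLength X c m (Unique-∖ _ Unique-V) (length-V∖ b∈V))) ⟩
    X * ∑[ b ∈ V ] hafnian (λ a b → X * X + c a b) (V ∖ b)
      ≈⟨ *P-congʳ X (∑-cong V λ b∈V → matchingSum-cong (Unique-∖ _ Unique-V) (λ _ → ≃-refl)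
                   (λ a∈ b∈ → S-offdiagonal² (∈-∖⇒∈ V a∈) (∈-∖⇒∈ V b∈))) ⟩
    X * ∑[ b ∈ V ] hafnian (λ a b → S a b ²) (V ∖ b)
      ≈⟨ *P-congʳ X (∑-cong V λ {b} _ → ≃-sym (hafnian-square S (V ∖ b))) ⟩
    X * ∑[ b ∈ V ] (hafnian S (V ∖ b) ²)
      ≈⟨ *P-congʳ X (∑-square _ V) ⟨
    X * (∑[ b ∈ V ] hafnian S (V ∖ b)) ²
      ≈⟨ *P-congʳ X (*P-cong Ψ≃∑-hafnian Ψ≃∑-hafnian) ⟨
    X * Ψ ² ∎
    where
    open ≃-Reasoning
    c = λ a b → constP (Â a b)

  S-sym : ∀ a b → S a b ≃ S b a
  S-sym zero    zero    = ≃-refl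
  S-sym zero    (suc b) = ≃-refl
  S-sym (suc a) zero    = ≃-refl
  S-sym (suc a) (suc b) rewrite δ-sym a b | symmetric G a b = ≃-refl

  S-diagonal : ∀ a → S a a ≃ []
  S-diagonal zero    = ≃-refl
  S-diagonal (suc a) rewrite δ-refl a | loopless G a = +P-self X

  ones : Vector Bool n
  ones _ = true

  A*-ones : A* ones ≗ (λ _ → false)
  A*-ones i = ≡.trans (sumF2-cong (λ l → ∧-identityʳ (A i l))) (sumF2-even (A i) (even-degree i))

  A*-δ-column : ∀ a l → A* (δ-column a) l ≡ A l a
  A*-δ-column a l = ≡.trans
    (sumF2-cong (λ k → ≡.trans (∧-comm (A l k) (δ k a)) (≡.cong (_∧ A l k) (δ-sym k a))))
    (sumF2-δ a (A l))

  S⊙ : ∀ a b v l → (S (suc a) (suc b) ⊙ v) l ≡ (A* v l xor (A a b ∧ v l)) xor (δ a b ∧ A* v l)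
  S⊙ a b v l = begin
    (((X +P constP (A a b)) +P scaleP (δ a b) X) ⊙ v) l
      ≡⟨ ⊙-distribʳ v (X +P constP (A a b)) (scaleP (δ a b) X) l ⟩
    ((X +P constP (A a b)) ⊙ v) l xor (scaleP (δ a b) X ⊙ v) l
      ≡⟨ ≡.cong₂ _xor_ (⊙-distribʳ v X (constP (A a b)) l) (⊙-scaleP (δ a b) X v l) ⟩
    ((X ⊙ v) l xor (constP (A a b) ⊙ v) l) xor (δ a b ∧ (X ⊙ v) l)
      ≡⟨ ≡.cong₂ _xor_ (≡.cong₂ _xor_ (X⊙ v l) (≡.cong ((A a b ∧ v l) xor_) (A*-false l)))
                       (≡.cong (δ a b ∧_) (X⊙ v l)) ⟩
    (A* v l xor ((A a b ∧ v l) xor false)) xor (δ a b ∧ A* v l)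
      ≡⟨ ≡.cong (λ t → (A* v l xor t) xor (δ a b ∧ A* v l)) (xor-identityʳ _) ⟩
    (A* v l xor (A a b ∧ v l)) xor (δ a b ∧ A* v l) ∎
    where open ≡.≡-Reasoning

  border : (Fin n → Vector Bool n) → Fin (suc n) → Vector Bool n
  border v zero    = λ _ → false
  border v (suc a) = v a

  column : (Fin n → Vector Bool n) → Fin (suc n) → Vector Bool n
  column v b = VectorSum.sumOver (λ a → S a b ⊙ border v a) (zero ∷ V)

  column-zero : ∀ v l → column v zero l ≡ sumF2 (λ a → v a l)
  column-zero v l = ≡.trans (∑ᴹ-tabulate (λ a → S a zero ⊙ border v a) suc l)
                            (sumF2-cong (λ a → ⊙-identityˡ (v a) l))

  column-suc : ∀ v b l → column v (suc b) l ≡ sumF2 (λ a → (S (suc a) (suc b) ⊙ v a) l)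
  column-suc v b l = ≡.cong₂ _xor_ (⊙-zeroʳ (true ∷ []) l) (∑ᴹ-tabulate (λ a → S a (suc b) ⊙ border v a) suc l)

  zero∉V : zero ∉ V
  zero∉V = Fin.0≢1+n ∘ proj₂ ∘ ∈-tabulate⁻

  Unique-zero∷V : Unique (zero ∷ V)
  Unique-zero∷V = ¬Any⇒All¬ V zero∉V ∷ Unique-V

  Ψ⊙border : ∀ v j → (∀ l → column v zero l ≡ true) → (∀ b l → column v (suc b) l ≡ false) →
             Ψ ⊙ v j ≗ hafnian S (V ∖ suc j) ⊙ ones
  Ψ⊙border v j column₀ column₊ l = begin
    (Ψ ⊙ v j) l
      ≡⟨ Cramer.hafnian-cramer S S-sym S-diagonal Unique-zero∷V (there (∈-tabulate⁺ j)) (border v) l ⟩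
    VectorSum.sumOver (λ b → hafnian S ((zero ∷ V) ∖ k ∖ b) ⊙ column v b) ((zero ∷ V) ∖ k) l
      ≡⟨ ≡.cong (λ N → VectorSum.sumOver (λ b → hafnian S (N ∖ b) ⊙ column v b) N l) (∖-∷-≢ V Fin.0≢1+n) ⟩
    (hafnian S ((zero ∷ V ∖ k) ∖ zero) ⊙ column v zero) l xor
      VectorSum.sumOver (λ b → hafnian S ((zero ∷ V ∖ k) ∖ b) ⊙ column v b) (V ∖ k) l
      ≡⟨ ≡.cong₂ _xor_ border-term (VectorSum.∑-zero (V ∖ k) vertex-term l) ⟩
    (hafnian S (V ∖ k) ⊙ ones) l xor false
      ≡⟨ xor-identityʳ _ ⟩
    (hafnian S (V ∖ k) ⊙ ones) l ∎
    where
    open ≡.≡-Reasoning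
    k = suc j
    border-term : (hafnian S ((zero ∷ V ∖ k) ∖ zero) ⊙ column v zero) l ≡ (hafnian S (V ∖ k) ⊙ ones) l
    border-term = ≡.trans (≡.cong (λ N → (hafnian S N ⊙ column v zero) l) (∖-head (zero∉V ∘ ∈-∖⇒∈ V)))
                          (⊙-congʳ (hafnian S (V ∖ k)) column₀ l)
    vertex-term : ∀ {b} → b ∈ V ∖ k → hafnian S ((zero ∷ V ∖ k) ∖ b) ⊙ column v b ≗ (λ _ → false)
    vertex-term {b} b∈ with ∈-tabulate⁻ (∈-∖⇒∈ V b∈)
    ... | b′ , ≡.refl = λ l′ →
      ≡.trans (⊙-congʳ (hafnian S ((zero ∷ V ∖ k) ∖ b)) (column₊ b′) l′) (⊙-zeroʳ (hafnian S ((zero ∷ V ∖ k) ∖ b)) l′)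

  -- Both sides equal Q(A) 𝟙 with Q = hafnian S (V ∖ suc j): take the weights e_a,
  -- respectively 𝟙, at the vertices in Ψ⊙border.
  Ψ⊙δ-column≗Ψ⊙ones : ∀ j → Ψ ⊙ δ-column j ≗ Ψ ⊙ ones
  Ψ⊙δ-column≗Ψ⊙ones j l = ≡.trans (Ψ⊙border δ-column j unit-column₀ unit-column₊ l)
                                   (≡.sym (Ψ⊙border (λ _ → ones) j ones-column₀ ones-column₊ l))
    where
    open ≡.≡-Reasoning
    unit-column₀ : ∀ l → column δ-column zero l ≡ true
    unit-column₀ l = ≡.trans (column-zero δ-column l)
      (≡.trans (sumF2-cong (λ a → ≡.sym (∧-identityʳ (δ l a)))) (sumF2-δ l (λ _ → true)))
    unit-column₊ : ∀ b l → column δ-column (suc b) l ≡ false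
    unit-column₊ b l = begin
      column δ-column (suc b) l
        ≡⟨ column-suc δ-column b l ⟩
      sumF2 (λ a → (S (suc a) (suc b) ⊙ δ-column a) l)
        ≡⟨ sumF2-cong (λ a → ≡.trans (S⊙ a b (δ-column a) l)
             (≡.cong₂ (λ s t → (s xor (A a b ∧ δ l a)) xor (δ a b ∧ t)) (A*-δ-column a l) (A*-δ-column a l))) ⟩
      sumF2 (λ a → (A l a xor (A a b ∧ δ l a)) xor (δ a b ∧ A l a))
        ≡⟨ ≡.trans (sumF2-xor (λ a → A l a xor (A a b ∧ δ l a)) (λ a → δ a b ∧ A l a))
                   (≡.cong (_xor sumF2 (λ a → δ a b ∧ A l a)) (sumF2-xor (A l) (λ a → A a b ∧ δ l a))) ⟩
      (sumF2 (A l) xor sumF2 (λ a → A a b ∧ δ l a)) xor sumF2 (λ a → δ a b ∧ A l a)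
        ≡⟨ ≡.cong₂ _xor_ (≡.cong₂ _xor_ (sumF2-even (A l) (even-degree l)) picks-A-l-b) picks-A-l-b′ ⟩
      (false xor A l b) xor A l b
        ≡⟨ xor-same (A l b) ⟩
      false ∎
      where
      picks-A-l-b : sumF2 (λ a → A a b ∧ δ l a) ≡ A l b
      picks-A-l-b = ≡.trans (sumF2-cong (λ a → ∧-comm (A a b) (δ l a))) (sumF2-δ l (λ a → A a b))
      picks-A-l-b′ : sumF2 (λ a → δ a b ∧ A l a) ≡ A l b
      picks-A-l-b′ = ≡.trans (sumF2-cong (λ a → ≡.cong (_∧ A l a) (δ-sym a b))) (sumF2-δ b (A l))
    ones-column₀ : ∀ l → column (λ _ → ones) zero l ≡ true
    ones-column₀ l = ≡.trans (column-zero (λ _ → ones) l)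
      (≡.trans (sumF2-const n true) (≡.trans (≡.cong (_× true) n≡) (×-odd m true)))
    ones-column₊ : ∀ b l → column (λ _ → ones) (suc b) l ≡ false
    ones-column₊ b l = begin
      column (λ _ → ones) (suc b) l
        ≡⟨ column-suc (λ _ → ones) b l ⟩
      sumF2 (λ a → (S (suc a) (suc b) ⊙ ones) l)
        ≡⟨ sumF2-cong (λ a → ≡.trans (S⊙ a b ones l)
             (≡.cong₂ (λ s t → (s xor (A a b ∧ true)) xor (δ a b ∧ t)) (A*-ones l) (A*-ones l))) ⟩
      sumF2 (λ a → (A a b ∧ true) xor (δ a b ∧ false))
        ≡⟨ sumF2-cong (λ a → ≡.cong₂ _xor_ (≡.trans (∧-identityʳ (A a b)) (symmetric G a b)) (∧-zeroʳ (δ a b))) ⟩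
      sumF2 (λ a → A b a xor false)
        ≡⟨ sumF2-cong (λ a → xor-identityʳ (A b a)) ⟩
      sumF2 (A b)
        ≡⟨ sumF2-even (A b) (even-degree b) ⟩
      false ∎

  X*P⊙ones : ∀ p → (X *P p) ⊙ ones ≗ (λ _ → false)
  X*P⊙ones p l = begin
    ((X *P p) ⊙ ones) l      ≡⟨ ⊙-congˡ (*P-comm X p) ones l ⟩
    ((p *P X) ⊙ ones) l      ≡⟨ ⊙-assoc p X ones l ⟩
    (p ⊙ X ⊙ ones) l         ≡⟨ ⊙-congʳ p (λ l′ → ≡.trans (X⊙ ones l′) (A*-ones l′)) l ⟩
    (p ⊙ (λ _ → false)) l    ≡⟨ ⊙-zeroʳ p l ⟩
    false                    ∎
    where open ≡.≡-Reasoning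

odd⇒≡1+2* : ∀ n → Odd n → ∃[ m ] n ≡ suc (2 ℕ.* m)
odd⇒≡1+2* n n-odd = n / 2 , (begin
  n                          ≡⟨ m≡m%n+[m/n]*n n 2 ⟩
  n % 2 ℕ.+ n / 2 ℕ.* 2      ≡⟨ ≡.cong (ℕ._+ n / 2 ℕ.* 2) n-odd ⟩
  suc (n / 2 ℕ.* 2)          ≡⟨ ≡.cong suc (ℕₚ.*-comm (n / 2) 2) ⟩
  suc (2 ℕ.* (n / 2))        ∎)
  where open ≡.≡-Reasoning

2*m/2≡m : ∀ m → 2 ℕ.* m / 2 ≡ m
2*m/2≡m m = ≡.trans (≡.cong (_/ 2) (ℕₚ.*-comm 2 m)) (m*n/n≡m m 2)

theorem7 : (n : ℕ) (G : Graph n) → Eulerian G → Odd n →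
    (φ₁ : Poly) (k : ℕ) → Odd k → 3 ≤ k →
    charPoly (adjMatrix G) ≈P ((X ^P k) *P (φ₁ ^P 2)) →
    ∀ i j → (((adjMatrix G) ^M ((k ∸ 1) / 2)) ⊗ evalM φ₁ (adjMatrix G)) i j ≡ false
theorem7 n G (_ , even-degree) n-odd φ₁ k k-odd 3≤k charPoly≈ i j
  with odd⇒≡1+2* n n-odd | odd⇒≡1+2* k k-odd
... | _ , _     | zero   , ≡.refl = contradiction 3≤k λ { (s≤s ()) }
... | m , n≡1+2m | suc h′ , ≡.refl = begin
  ((A ^M (2 ℕ.* h / 2)) ⊗ evalM φ₁ A) i j        ≡⟨ ≡.cong (λ e → ((A ^M e) ⊗ evalM φ₁ A) i j) (2*m/2≡m h) ⟩
  ((A ^M h) ⊗ evalM φ₁ A) i j                    ≡⟨ ^M-⊗-evalM h φ₁ i j ⟩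
  (((X ^P h) *P φ₁) ⊙ δ-column j) i              ≡⟨ ⊙-congˡ Ψ≃X^h*φ₁ (δ-column j) i ⟨
  (Ψ ⊙ δ-column j) i                             ≡⟨ Ψ⊙δ-column≗Ψ⊙ones j i ⟩
  (Ψ ⊙ ones) i                                   ≡⟨ ⊙-congˡ (≃-trans Ψ≃X^h*φ₁ (*P-assoc X (X ^P h′) φ₁)) ones i ⟩
  ((X *P ((X ^P h′) *P φ₁)) ⊙ ones) i            ≡⟨ X*P⊙ones ((X ^P h′) *P φ₁) i ⟩
  false                                          ∎
  where
  open ≡.≡-Reasoning
  h = suc h′
  open BorderedHafnian G even-degree m n≡1+2m
  open PolynomialAction A
  Ψ≃X^h*φ₁ : Ψ ≃ ((X ^P h) *P φ₁)
  Ψ≃X^h*φ₁ = square-injective (X*P-cancel (≃-trans (≃-sym charPoly≃X*Ψ²)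
               (≃-trans (coefficientwise charPoly≈) (X^[1+2h]*P² h φ₁))))
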